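{- Let $n=p'^{\,2}q$ where $p',q$ are distinct primes, both at least $7$, and let $A=S(n)$. Then $D_A(n)=5$.
   Context: $\mathbb{Z}_n=\mathbb{Z}/n\mathbb{Z}$, $U(n)$ its unit group. For nonempty $A\subseteq\mathbb{Z}_n\setminus\{0\}$, a sequence $(x_1,\ldots,x_l)$ is an $A$-weighted zero-sum sequence if $a_1x_1+\cdots+a_lx_l=0$ for some $a_i\in A$; subsequences are nonempty; $D_A(n)$ is the least $k$ such that every sequence of length $k$ in $\mathbb{Z}_n$ has an $A$-weighted zero-sum subsequence. For odd $n=\prod p_i^{r_i}$ and $a\in U(n)$, $\left(\frac{a}{n}\right)=\prod_i\left(\frac{a\bmod p_i}{p_i}\right)^{r_i}$ (Legendre symbols), and $S(n)$ is the kernel of $a\mapsto\left(\frac{a}{n}\right)$ on $U(n)$. -}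

module Defs where

open import Data.Nat using (ℕ; zero; suc; _+_; _*_; _^_; _<_; _≤_; ∣_-_∣)
open import Data.Nat.Divisibility using (_∣_; _∣?_)
open import Data.Nat.Coprimality using (Coprime)
open import Data.Integer as ℤ using (ℤ; +_; -[1+_])
open import Data.Bool using (Bool; true; false; if_then_else_)
open import Data.List using (List; []; _∷_; upTo)
open import Data.Bool.ListAction using (any)
open import Data.Vec as Vec using (head; tail)
open import Data.Product using (_×_; _,_; ∃; Σ-syntax)
open import Data.Fin using (Fin; toℕ)
open import Data.Fin.Subset using (Subset; _∈_; Nonempty)
open import Relation.Nullary using (¬_; does)
open import Relation.Binary.PropositionalEquality using (_≡_; _≢_)

isSquareMod : ℕ → ℕ → Bool
isSquareMod m a = any (λ x → does (m ∣? ∣ x * x - a ∣)) (upTo m)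

-- Legendre symbol (a/p) for a prime p not dividing a: +1 if a is a QR mod p, else -1
legendre : ℕ → ℕ → ℤ
legendre p a = if isSquareMod p a then + 1 else -[1+ 0 ]

-- (a/n) = ∏ (a mod p_i / p_i)^{r_i}, for n = ∏ p_i^{r_i} given as a list of (p_i , r_i)
jacobiFact : List (ℕ × ℕ) → ℕ → ℤ
jacobiFact [] a = + 1
jacobiFact ((p , r) ∷ fs) a = (legendre p a ℤ.^ r) ℤ.* jacobiFact fs a

IsUnit : (n : ℕ) → Fin n → Set
IsUnit n a = Coprime (toℕ a) n

InS : (n : ℕ) → List (ℕ × ℕ) → Fin n → Set
InS n fs a = IsUnit n a × jacobiFact fs (toℕ a) ≡ + 1

weightedSum : {n : ℕ} (k : ℕ) → Subset k → (Fin k → Fin n) → (Fin k → Fin n) → ℕ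
weightedSum zero I a x = 0
weightedSum {n} (suc k) I a x =
  (if head I then toℕ (a Fin.zero) * toℕ (x Fin.zero) else 0)
  + weightedSum k (tail I) (λ i → a (Fin.suc i)) (λ i → x (Fin.suc i))
  where import Data.Fin as Fin

HasWeightedZeroSum : (n : ℕ) → (Fin n → Set) → (k : ℕ) → (Fin k → Fin n) → Set
HasWeightedZeroSum n A k x =
  ∃ λ (I : Subset k) → Nonempty I ×
    Σ[ a ∈ (Fin k → Fin n) ] ((∀ i → i ∈ I → A (a i)) × (n ∣ weightedSum k I a x))

AllHaveZeroSum : (n : ℕ) → (Fin n → Set) → ℕ → Set
AllHaveZeroSum n A k = (x : Fin k → Fin n) → HasWeightedZeroSum n A k x

DavenportConst≡ : (n : ℕ) → (Fin n → Set) → ℕ → Set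
DavenportConst≡ n A d = AllHaveZeroSum n A d × (∀ k → k < d → ¬ AllHaveZeroSum n A k)

-- By the Chinese remainder theorem ℤₙ ≅ ℤ_{p²} × ℤ_q, and since
-- (a/n) = (a/p)²(a/q) = (a/q), the weights S(n) correspond to the pairs
-- (unit mod p², nonzero square mod q). So a subsequence indexed by I is an
-- S(n)-weighted zero-sum as soon as 0 is a unit-weighted sum of it modulo p² and
-- a square-weighted sum of it modulo q.
--
-- Modulo q (q ≥ 7): with no term prime to q, 0 is reached; with three or more,
-- everything is, because two of them lie in the same square class and every
-- nonzero residue is a sum of two nonzero squares. Modulo p², what is reached
-- depends only on how many terms are units and how many are exactly divisible
-- by p, and contains 0 unless there is exactly one unit, or no unit and exactly
-- one term exactly divisible by p. A finite check over the 2⁵·3⁵ patterns of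
-- five terms finds a nonempty I meeting both conditions, so D ≤ 5.
--
-- Conversely, for a non-residue r modulo q the sequence (p², -rp², q, pq) has no
-- such zero-sum: modulo p the term q must be absent, then modulo p² the term pq,
-- and modulo q the terms p² and -rp² cancel only if r is a square.

module Submission where

open import Data.Bool using (Bool; true; false; T; _∧_; if_then_else_)
open import Data.Bool.ListAction using (all; any)
open import Data.Bool.Properties using (T-∧)
open import Data.Empty using (⊥; ⊥-elim)
open import Data.Fin as Fin using (Fin; toℕ; fromℕ<; #_)
import Data.Fin.Properties as Fin
open import Data.Fin.Subset using (Subset; _∈_; _∉_; Nonempty; inside; outside)
open import Data.Fin.Subset.Properties using (nonempty?; ∉⊥)
open import Data.Integer as ℤ using (ℤ; +_; -[1+_]; _+_; _*_; _-_; -_; _⊖_; 0ℤ; 1ℤ)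
import Data.Integer.Coprimality as ℤ
import Data.Integer.DivMod as ℤ
open import Data.Integer.Divisibility.Signed
import Data.Integer.Properties as ℤ
open import Data.Integer.Tactic.RingSolver using (solve-∀)
open import Data.List using (List; []; _∷_; upTo)
import Data.List.Membership.Propositional as List
open import Data.List.Membership.Propositional.Properties using (∈-upTo⁺)
import Data.List.Relation.Unary.Any as Any
open import Data.List.Relation.Unary.Any.Properties using (any⁺; any⁻)
open import Data.Nat as ℕ using (ℕ; zero; suc; NonZero; _^_; z≤n; s≤s)
open import Data.Nat.Coprimality as Coprime using (Coprime; coprime-Bézout)
import Data.Nat.Divisibility as ℕ
open import Data.Nat.GCD using (module Bézout)
open import Data.Nat.Primality using (Prime; euclidsLemma; prime⇒irreducible; prime⇒nonZero; prime⇒nonTrivial)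
import Data.Nat.Properties as ℕ
open import Data.Product using (_×_; _,_; ∃; ∃₂; proj₁; proj₂)
open import Data.Sum using (_⊎_; inj₁; inj₂; [_,_]′)
open import Data.Unit using (⊤; tt)
open import Data.Vec using (Vec; []; _∷_; here; there; tabulate)
open import Function using (_∘_; _$_)
open import Function.Bundles using (_⇔_; mk⇔; Equivalence)
open import Relation.Nullary using (¬_; Dec; yes; no; ¬?; does)
open import Relation.Nullary.Decidable using (decidable-stable; map′; toWitness; isYes≗does; dec-true)
open import Relation.Binary.PropositionalEquality

open import Defs

∣m⊖n∣≡∣m-n∣ : ∀ m n → ℤ.∣ m ⊖ n ∣ ≡ ℕ.∣ m - n ∣
∣m⊖n∣≡∣m-n∣ zero    zero    = refl
∣m⊖n∣≡∣m-n∣ zero    (suc n) = refl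
∣m⊖n∣≡∣m-n∣ (suc m) zero    = refl
∣m⊖n∣≡∣m-n∣ (suc m) (suc n) = trans (cong ℤ.∣_∣ (ℤ.[1+m]⊖[1+n]≡m⊖n m n)) (∣m⊖n∣≡∣m-n∣ m n)

∣+a-+b∣≡∣a-b∣ : ∀ a b → ℤ.∣ + a - + b ∣ ≡ ℕ.∣ a - b ∣
∣+a-+b∣≡∣a-b∣ a b = trans (cong ℤ.∣_∣ (ℤ.m-n≡m⊖n a b)) (∣m⊖n∣≡∣m-n∣ a b)

≡0⇒∣ : ∀ {m a} → a ≡ 0ℤ → + m ∣ a
≡0⇒∣ refl = divides 0ℤ refl

∣-sub-0 : ∀ {m a} → + m ∣ a - 0ℤ → + m ∣ a
∣-sub-0 {a = a} = subst (_ ∣_) (ℤ.+-identityʳ a)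

∣⇒∣-sub-0 : ∀ {m a} → + m ∣ a → + m ∣ a - 0ℤ
∣⇒∣-sub-0 {a = a} = subst (_ ∣_) (sym (ℤ.+-identityʳ a))

module _ {m : ℕ} where

  ∣-sub-sym : ∀ a b → + m ∣ a - b → + m ∣ b - a
  ∣-sub-sym a b m∣a-b = subst (+ m ∣_) (negate a b) (∣m⇒∣-m m∣a-b)
    where
      negate : ∀ a b → - (a - b) ≡ b - a
      negate = solve-∀

  ∣-sub-trans : ∀ a b c → + m ∣ a - b → + m ∣ b - c → + m ∣ a - c
  ∣-sub-trans a b c m∣a-b m∣b-c = subst (+ m ∣_) (telescope a b c) (∣m∣n⇒∣m+n m∣a-b m∣b-c)
    where
      telescope : ∀ a b c → a - b + (b - c) ≡ a - c
      telescope = solve-∀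

  ∣-sub-∣ : ∀ {a b} → + m ∣ a - b → + m ∣ b → + m ∣ a
  ∣-sub-∣ {a} {b} m∣a-b m∣b = subst (+ m ∣_) (cancel a b) (∣m∣n⇒∣m+n m∣a-b m∣b)
    where
      cancel : ∀ a b → a - b + b ≡ a
      cancel = solve-∀

  ∤-sub-∤ : ∀ {a b} → + m ∣ a - b → ¬ + m ∣ a → ¬ + m ∣ b
  ∤-sub-∤ m∣a-b m∤a m∣b = m∤a (∣-sub-∣ m∣a-b m∣b)

  ∣-sub-refl : ∀ a → + m ∣ a - a
  ∣-sub-refl a = subst (+ m ∣_) (sym (ℤ.+-inverseʳ a)) (divides 0ℤ refl)

∤-between : ∀ {m} d → 0 ℕ.< d → d ℕ.< m → ¬ + m ∣ + d
∤-between (suc d) _ d<m m∣d = ℕ.<⇒≱ d<m (ℕ.∣⇒≤ (∣⇒∣ᵤ m∣d))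

∣-small-difference⇒≡ : ∀ {m a b} → a ℕ.< m → b ℕ.< m → + m ∣ + a - + b → a ≡ b
∣-small-difference⇒≡ {m} {a} {b} a<m b<m m∣a-b = ℕ.∣m-n∣≡0⇒m≡n
  (small-multiple (subst (m ℕ.∣_) (∣+a-+b∣≡∣a-b∣ a b) (∣⇒∣ᵤ m∣a-b))
                  (ℕ.≤-<-trans (ℕ.∣m-n∣≤m⊔n a b) (ℕ.⊔-lub a<m b<m)))
  where
    small-multiple : ∀ {d} → m ℕ.∣ d → d ℕ.< m → d ≡ 0
    small-multiple {zero}  _   _   = refl
    small-multiple {suc d} m∣d d<m = ⊥-elim (ℕ.<⇒≱ d<m (ℕ.∣⇒≤ m∣d))

prime⇒1< : ∀ {p} → Prime p → 1 ℕ.< p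
prime⇒1< p-prime = ℕ.nonTrivial⇒n>1 _ {{prime⇒nonTrivial p-prime}}

prime-∣-* : ∀ {p} → Prime p → ∀ a b → + p ∣ a * b → + p ∣ a ⊎ + p ∣ b
prime-∣-* {p} p-prime a b p∣ab
  with euclidsLemma ℤ.∣ a ∣ ℤ.∣ b ∣ p-prime (subst (p ℕ.∣_) (ℤ.abs-* a b) (∣⇒∣ᵤ p∣ab))
... | inj₁ p∣a = inj₁ (∣ᵤ⇒∣ p∣a)
... | inj₂ p∣b = inj₂ (∣ᵤ⇒∣ p∣b)

prime-∤-* : ∀ {p} → Prime p → ∀ {a b} → ¬ + p ∣ a → ¬ + p ∣ b → ¬ + p ∣ a * b
prime-∤-* p-prime {a} {b} p∤a p∤b p∣ab = [ p∤a , p∤b ]′ (prime-∣-* p-prime a b p∣ab)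

prime-∤-prime : ∀ {p q} → Prime p → Prime q → p ≢ q → ¬ + p ∣ + q
prime-∤-prime p-prime q-prime p≢q p∣q =
  [ ℕ.>⇒≢ (prime⇒1< p-prime) , p≢q ]′ (prime⇒irreducible q-prime (∣⇒∣ᵤ p∣q))

one-of-two-∤ : ∀ {p} → Prime p → ∀ c₁ c₂ {z} → ¬ + p ∣ c₂ - c₁ → ¬ + p ∣ z → ∀ t →
               ¬ + p ∣ t - c₁ * z ⊎ ¬ + p ∣ t - c₂ * z
one-of-two-∤ {p} p-prime c₁ c₂ {z} p∤c p∤z t with + p ∣? t - c₁ * z
... | no  p∤t-c₁z = inj₁ p∤t-c₁z
... | yes p∣t-c₁z = inj₂ λ p∣t-c₂z →
        prime-∤-* p-prime p∤c p∤z (subst (+ p ∣_) (difference t c₁ c₂ z) (∣m∣n⇒∣m-n p∣t-c₁z p∣t-c₂z))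
  where
    difference : ∀ t c₁ c₂ z → t - c₁ * z - (t - c₂ * z) ≡ (c₂ - c₁) * z
    difference = solve-∀

parity : ∀ n → (∃ λ h → n ≡ h ℕ.+ h) ⊎ (∃ λ h → n ≡ suc (h ℕ.+ h))
parity zero = inj₁ (0 , refl)
parity (suc n) with parity n
... | inj₁ (h , n≡2h)   = inj₂ (h , cong suc n≡2h)
... | inj₂ (h , n≡2h+1) = inj₁ (suc h , cong suc (trans n≡2h+1 (sym (ℕ.+-suc h h))))

odd-prime : ∀ {q} → Prime q → 2 ℕ.< q → ∃ λ h → q ≡ suc (h ℕ.+ h)
odd-prime {q} q-prime 2<q = [ even-impossible , (λ odd → odd) ]′ (parity q)
  where
    even-impossible : (∃ λ h → q ≡ h ℕ.+ h) → ∃ λ h → q ≡ suc (h ℕ.+ h)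
    even-impossible (h , q≡2h) = ⊥-elim ([ (λ ()) , (λ 2≡q → ℕ.<-irrefl 2≡q 2<q) ]′ (prime⇒irreducible q-prime 2∣q))
      where
        2∣q : 2 ℕ.∣ q
        2∣q = ℕ.divides h (trans q≡2h (trans (cong (h ℕ.+_) (sym (ℕ.+-identityʳ h))) (ℕ.*-comm 2 h)))

coprime-* : ∀ {a m n} → Coprime a m → Coprime a n → Coprime a (m ℕ.* n)
coprime-* {a} {m} {n} a⊥m a⊥n {d} (d∣a , d∣mn) = a⊥n (d∣a , Coprime.coprime-divisor d⊥m d∣mn)
  where
    d⊥m : Coprime d m
    d⊥m {e} (e∣d , e∣m) = a⊥m (ℕ.∣-trans e∣d d∣a , e∣m)

coprime-^2 : ∀ {a p} → Coprime a p → Coprime a (p ^ 2)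
coprime-^2 {a} a⊥p = coprime-* a⊥p (coprime-* a⊥p (Coprime.sym (Coprime.1-coprimeTo a)))

prime-∤⇒coprime : ∀ {p} → Prime p → ∀ a → ¬ + p ∣ a → Coprime ℤ.∣ a ∣ p
prime-∤⇒coprime p-prime a p∤a {d} (d∣a , d∣p) with prime⇒irreducible p-prime d∣p
... | inj₁ d≡1 = d≡1
... | inj₂ refl = ⊥-elim (p∤a (∣ᵤ⇒∣ d∣a))

+-moveʳ : ∀ {a b c} → a + b ≡ c → c - b ≡ a
+-moveʳ {a} {b} refl = [a+b]-b≡a a b
  where
    [a+b]-b≡a : ∀ a b → a + b - b ≡ a
    [a+b]-b≡a = solve-∀

ℕ-identity⇒ℤ : ∀ d a b c e → d ℕ.+ a ℕ.* b ≡ c ℕ.* e → + d + + a * + b ≡ + c * + e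
ℕ-identity⇒ℤ d a b c e eq = begin
  + d + + a * + b   ≡⟨ cong (λ z → + d + z) (ℤ.pos-* a b) ⟨
  + d + + (a ℕ.* b) ≡⟨ ℤ.pos-+ d _ ⟨
  + (d ℕ.+ a ℕ.* b) ≡⟨ cong +_ eq ⟩
  + (c ℕ.* e)       ≡⟨ ℤ.pos-* c e ⟩
  + c * + e         ∎
  where open ≡-Reasoning

bézoutℤ : ∀ {m n} → Coprime m n → ∃₂ λ x y → + m * x + + n * y ≡ 1ℤ
bézoutℤ {m} {n} c with coprime-Bézout c
... | Bézout.+- x y eq = + x , - + y , trans (reorder (+ m) (+ n) (+ x) (+ y)) (+-moveʳ (ℕ-identity⇒ℤ 1 y n x m eq))
  where
    reorder : ∀ m n x y → m * x + n * - y ≡ x * m - y * n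
    reorder = solve-∀
... | Bézout.-+ x y eq = - + x , + y , trans (reorder (+ m) (+ n) (+ x) (+ y)) (+-moveʳ (ℕ-identity⇒ℤ 1 x m y n eq))
  where
    reorder : ∀ m n x y → m * - x + n * y ≡ y * n - x * m
    reorder = solve-∀

bézout⇒∣ : ∀ {m} u v → u + + m * v ≡ 1ℤ → + m ∣ u - 1ℤ
bézout⇒∣ {m} u v eq = divides (- v) (trans (cong (λ z → u - z) (sym eq)) (cancel u (+ m) v))
  where
    cancel : ∀ u m v → u - (u + m * v) ≡ - v * m
    cancel = solve-∀

inverse-mod : ∀ {m} a → Coprime ℤ.∣ a ∣ m → ∃ λ b → + m ∣ a * b - 1ℤ
inverse-mod {m} a c with bézoutℤ c | ℤ.+∣i∣≡i⊎+∣i∣≡-i a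
... | x , y , eq | inj₁ |a|≡a  = x , bézout⇒∣ (a * x) y (subst (λ u → u * x + + m * y ≡ 1ℤ) |a|≡a eq)
... | x , y , eq | inj₂ |a|≡-a = - x , bézout⇒∣ (a * - x) y (trans (cong (_+ + m * y) a*-x≡|a|*x) eq)
  where
    a*-x≡|a|*x : a * - x ≡ + ℤ.∣ a ∣ * x
    a*-x≡|a|*x = trans (sym (ℤ.neg-distribʳ-* a x)) (trans (ℤ.neg-distribˡ-* a x) (cong (_* x) (sym |a|≡-a)))

∣-*-1⇒∤ : ∀ {m} → 1 ℕ.< m → ∀ {a b} → + m ∣ a * b - 1ℤ → ¬ + m ∣ b
∣-*-1⇒∤ 1<m {a} {b} ab≡1 m∣b =
  ∤-between 1 (s≤s z≤n) 1<m (subst (_ ∣_) (cancel a b) (∣m∣n⇒∣m-n (∣n⇒∣m*n a m∣b) ab≡1))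
  where
    cancel : ∀ a b → a * b - (a * b - 1ℤ) ≡ 1ℤ
    cancel = solve-∀

crt : ∀ {M N} → Coprime M N → ∀ α β → ∃ λ c → + N ∣ c - α × + M ∣ c - β
crt {M} {N} M⊥N α β with bézoutℤ M⊥N
... | x , y , Mx+Ny≡1 =
  c , divides (y * (β - α)) (trans (times-1 α) (split-α α β (+ M) (+ N) x y)) ,
      divides (x * (α - β)) (trans (times-1 β) (split-β α β (+ M) (+ N) x y))
  where
    c : ℤ
    c = α * (+ M * x) + β * (+ N * y)
    times-1 : ∀ γ → c - γ ≡ c - γ * (+ M * x + + N * y)
    times-1 γ = trans (cong (λ u → c - u) (sym (ℤ.*-identityʳ γ))) (cong (λ u → c - γ * u) (sym Mx+Ny≡1))
    split-α : ∀ α β M N x y → α * (M * x) + β * (N * y) - α * (M * x + N * y) ≡ y * (β - α) * N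
    split-α = solve-∀
    split-β : ∀ α β M N x y → α * (M * x) + β * (N * y) - β * (M * x + N * y) ≡ x * (α - β) * M
    split-β = solve-∀

coprime-∣⇒*∣ : ∀ {M N a} → Coprime M N → + M ∣ a → + N ∣ a → + (M ℕ.* N) ∣ a
coprime-∣⇒*∣ {M} {N} {a} M⊥N M∣a (divides k a≡kN)
  with ∣ᵤ⇒∣ {+ M} {k} (ℤ.coprime-divisor (+ M) (+ N) k M⊥N
         (∣⇒∣ᵤ (subst (+ M ∣_) (trans a≡kN (ℤ.*-comm k (+ N))) M∣a)))
... | divides l k≡lM = divides l (begin
  a                 ≡⟨ a≡kN ⟩
  k * + N           ≡⟨ cong (_* + N) k≡lM ⟩
  l * + M * + N     ≡⟨ ℤ.*-assoc l (+ M) (+ N) ⟩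
  l * (+ M * + N)   ≡⟨ cong (l *_) (ℤ.pos-* M N) ⟨
  l * + (M ℕ.* N)   ∎)
  where open ≡-Reasoning

module Residues (m : ℕ) {{_ : NonZero m}} where

  residue : ℤ → ℕ
  residue a = a ℤ.% + m

  residue<m : ∀ a → residue a ℕ.< m
  residue<m a = ℤ.n%d<d a (+ m)

  ∣-residue : ∀ a → + m ∣ a - + residue a
  ∣-residue a = divides (a ℤ./ + m)
    (trans (cong (_- + residue a) (ℤ.a≡a%n+[a/n]*n a (+ m))) (cancel (+ residue a) (a ℤ./ + m) (+ m)))
    where
      cancel : ∀ r k m → r + k * m - r ≡ k * m
      cancel = solve-∀

  residue-≡⇒∣ : ∀ {a b} → residue a ≡ residue b → + m ∣ a - b
  residue-≡⇒∣ {a} {b} eq = subst (+ m ∣_) (regroup a b (+ residue b))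
    (∣m∣n⇒∣m-n (subst (λ r → + m ∣ a - + r) eq (∣-residue a)) (∣-residue b))
    where
      regroup : ∀ a b r → a - r - (b - r) ≡ a - b
      regroup = solve-∀

  ∤⇒residue≢0 : ∀ {a} → ¬ + m ∣ a → residue a ≢ 0
  ∤⇒residue≢0 {a} m∤a eq = m∤a (subst (+ m ∣_) (ℤ.+-identityʳ a) (subst (λ r → + m ∣ a - + r) eq (∣-residue a)))

  -- residues of non-multiples lie in [1, m), so pred sends them into Fin (pred m)
  pigeonhole-∤ : ∀ {N} → m ℕ.≤ N → (f : Fin N → ℤ) → (∀ i → ¬ + m ∣ f i) →
                 ∃₂ λ i j → i Fin.< j × + m ∣ f i - f j
  pigeonhole-∤ {N} m≤N f m∤f = collide (Fin.pigeonhole pred-m<N (λ i → fromℕ< (slot< i)))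
    where
      instance
        residue≢0 : ∀ {i} → NonZero (residue (f i))
        residue≢0 {i} = ℕ.≢-nonZero (∤⇒residue≢0 (m∤f i))
      pred-m<N : ℕ.pred m ℕ.< N
      pred-m<N = ℕ.<-≤-trans (subst (ℕ.pred m ℕ.<_) (ℕ.suc-pred m) (ℕ.n<1+n _)) m≤N
      slot< : ∀ i → ℕ.pred (residue (f i)) ℕ.< ℕ.pred m
      slot< i = ℕ.pred-mono-< (residue<m (f i))
      collide : (∃₂ λ i j → i Fin.< j × fromℕ< (slot< i) ≡ fromℕ< (slot< j)) →
                ∃₂ λ i j → i Fin.< j × + m ∣ f i - f j
      collide (i , j , i<j , same-slot) = i , j , i<j , residue-≡⇒∣ {f i} {f j} (ℕ.pred-injective
        (trans (sym (Fin.toℕ-fromℕ< (slot< i))) (trans (cong toℕ same-slot) (Fin.toℕ-fromℕ< (slot< j)))))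

  ∃-residue? : {P : ℤ → Set} → (∀ s t → + m ∣ s - t → P s → P t) → (∀ t → Dec (P t)) → Dec (∃ P)
  ∃-residue? {P} P-cong P? = map′ (λ (i , P[i]) → + toℕ i , P[i])
    (λ (t , P[t]) → fromℕ< (residue<m t) ,
                    subst (P ∘ +_) (sym (Fin.toℕ-fromℕ< (residue<m t))) (P-cong t _ (∣-residue t) P[t]))
    (Fin.any? λ (i : Fin m) → P? (+ toℕ i))

  reduce : ℤ → Fin m
  reduce a = fromℕ< (residue<m a)

  ∣-reduce : ∀ a → + m ∣ + toℕ (reduce a) - a
  ∣-reduce a = subst (λ r → + m ∣ + r - a) (sym (Fin.toℕ-fromℕ< (residue<m a))) (∣-sub-sym a _ (∣-residue a))

weightedSumℤ : ∀ {k} → Subset k → (Fin k → ℤ) → (Fin k → ℤ) → ℤ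
weightedSumℤ []            a x = 0ℤ
weightedSumℤ (inside ∷ I)  a x = a Fin.zero * x Fin.zero + weightedSumℤ I (a ∘ Fin.suc) (x ∘ Fin.suc)
weightedSumℤ (outside ∷ I) a x = weightedSumℤ I (a ∘ Fin.suc) (x ∘ Fin.suc)

weightedSum≡weightedSumℤ : ∀ {n} k I (a x : Fin k → Fin n) →
  + weightedSum k I a x ≡ weightedSumℤ I (λ i → + toℕ (a i)) (λ i → + toℕ (x i))
weightedSum≡weightedSumℤ zero    []            a x = refl
weightedSum≡weightedSumℤ (suc k) (inside ∷ I)  a x =
  trans (ℤ.pos-+ (toℕ (a Fin.zero) ℕ.* toℕ (x Fin.zero)) _)
        (cong₂ _+_ (ℤ.pos-* (toℕ (a Fin.zero)) (toℕ (x Fin.zero)))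
                   (weightedSum≡weightedSumℤ k I (a ∘ Fin.suc) (x ∘ Fin.suc)))
weightedSum≡weightedSumℤ (suc k) (outside ∷ I) a x = weightedSum≡weightedSumℤ k I (a ∘ Fin.suc) (x ∘ Fin.suc)

weightedSumℤ-cong : ∀ {m k} (I : Subset k) (a b x y : Fin k → ℤ) →
  (∀ i → i ∈ I → + m ∣ a i - b i) → (∀ i → i ∈ I → + m ∣ x i - y i) →
  + m ∣ weightedSumℤ I a x - weightedSumℤ I b y
weightedSumℤ-cong []            a b x y _ _ = divides 0ℤ refl
weightedSumℤ-cong (inside ∷ I)  a b x y a≡b x≡y = subst (_ ∣_)
  (regroup (a Fin.zero) (b Fin.zero) (x Fin.zero) (y Fin.zero) (weightedSumℤ I _ _) (weightedSumℤ I _ _))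
  (∣m∣n⇒∣m+n (∣m∣n⇒∣m+n (∣m⇒∣m*n (x Fin.zero) (a≡b Fin.zero here))
                        (∣n⇒∣m*n (b Fin.zero) (x≡y Fin.zero here)))
    (weightedSumℤ-cong I _ _ _ _ (λ i i∈I → a≡b (Fin.suc i) (there i∈I)) (λ i i∈I → x≡y (Fin.suc i) (there i∈I))))
  where
    regroup : ∀ a b x y s t → (a - b) * x + b * (x - y) + (s - t) ≡ a * x + s - (b * y + t)
    regroup = solve-∀
weightedSumℤ-cong (outside ∷ I) a b x y a≡b x≡y =
  weightedSumℤ-cong I _ _ _ _ (λ i i∈I → a≡b (Fin.suc i) (there i∈I)) (λ i i∈I → x≡y (Fin.suc i) (there i∈I))

weightedSumℤ-zero : ∀ {k} (I : Subset k) w → weightedSumℤ I w (λ _ → 0ℤ) ≡ 0ℤ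
weightedSumℤ-zero []            w = refl
weightedSumℤ-zero (inside ∷ I)  w = cong₂ _+_ (ℤ.*-zeroʳ (w Fin.zero)) (weightedSumℤ-zero I (w ∘ Fin.suc))
weightedSumℤ-zero (outside ∷ I) w = weightedSumℤ-zero I (w ∘ Fin.suc)

indicator : ∀ {k} → Fin k → ℤ → Fin k → ℤ
indicator j c i = if does (i Fin.≟ j) then c else 0ℤ

weightedSumℤ-indicator : ∀ {k} (I : Subset k) w j c → j ∈ I → weightedSumℤ I w (indicator j c) ≡ w j * c
weightedSumℤ-indicator (inside ∷ I)  w Fin.zero    c here =
  trans (cong (λ s → w Fin.zero * c + s) (weightedSumℤ-zero I (w ∘ Fin.suc))) (ℤ.+-identityʳ _)
weightedSumℤ-indicator (inside ∷ I)  w (Fin.suc j) c (there j∈I) =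
  trans (cong (_+ weightedSumℤ I (w ∘ Fin.suc) (indicator j c)) (ℤ.*-zeroʳ (w Fin.zero)))
        (trans (ℤ.+-identityˡ _) (weightedSumℤ-indicator I (w ∘ Fin.suc) j c j∈I))
weightedSumℤ-indicator (outside ∷ I) w (Fin.suc j) c (there j∈I) = weightedSumℤ-indicator I (w ∘ Fin.suc) j c j∈I

∣-weightedSumℤ-cong : ∀ {m k} {I : Subset k} a b x y → + m ∣ weightedSumℤ I a x →
                      (∀ i → i ∈ I → + m ∣ a i - b i) → (∀ i → i ∈ I → + m ∣ x i - y i) →
                      + m ∣ weightedSumℤ I b y
∣-weightedSumℤ-cong {I = I} a b x y m∣Σ a≡b x≡y =
  ∣-sub-∣ (∣-sub-sym (weightedSumℤ I a x) _ (weightedSumℤ-cong I a b x y a≡b x≡y)) m∣Σ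

record Reaches (m : ℕ) (W : ℤ → Set) {k} (I : Subset k) (x : Fin k → ℤ) (t : ℤ) : Set where
  constructor reach
  field
    weight    : Fin k → ℤ
    weight∈W  : ∀ i → i ∈ I → W (weight i)
    sum≡t     : + m ∣ weightedSumℤ I weight x - t

module _ {m : ℕ} {W : ℤ → Set} where

  reaches-cong : ∀ {k} {I : Subset k} {x t} t′ → + m ∣ t - t′ → Reaches m W I x t → Reaches m W I x t′
  reaches-cong {I = I} {x} {t} t′ t≡t′ (reach w w∈W Σ≡t) =
    reach w w∈W (∣-sub-trans (weightedSumℤ I w x) t t′ Σ≡t t≡t′)

  reaches-[] : ∀ {x t} → + m ∣ t → Reaches m W [] x t
  reaches-[] {t = t} m∣t = reach (λ ()) (λ _ ()) (subst (+ m ∣_) (sym (ℤ.+-identityˡ (- t))) (∣m⇒∣-m m∣t))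

  reaches-outside : ∀ {k} {I : Subset k} {x t} → Reaches m W I (x ∘ Fin.suc) t → Reaches m W (outside ∷ I) x t
  reaches-outside {x = x} (reach w w∈W Σ≡t) = reach extend extend∈W Σ≡t
    where
      extend : Fin (suc _) → ℤ
      extend Fin.zero    = 0ℤ
      extend (Fin.suc i) = w i
      extend∈W : ∀ i → i ∈ (outside ∷ _) → W (extend i)
      extend∈W (Fin.suc i) (there i∈I) = w∈W i i∈I

  reaches-inside : ∀ {k} {I : Subset k} {x t} b → W b →
                   Reaches m W I (x ∘ Fin.suc) (t - b * x Fin.zero) → Reaches m W (inside ∷ I) x t
  reaches-inside {I = I} {x} {t} b b∈W (reach w w∈W Σ≡t) = reach extend extend∈W
    (subst (+ m ∣_) (regroup b (x Fin.zero) (weightedSumℤ I w (x ∘ Fin.suc)) t) Σ≡t)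
    where
      extend : Fin (suc _) → ℤ
      extend Fin.zero    = b
      extend (Fin.suc i) = w i
      extend∈W : ∀ i → i ∈ (inside ∷ I) → W (extend i)
      extend∈W Fin.zero    here        = b∈W
      extend∈W (Fin.suc i) (there i∈I) = w∈W i i∈I
      regroup : ∀ b x s t → s - (t - b * x) ≡ b * x + s - t
      regroup = solve-∀

  reaches-extend : ∀ {k} {I : Subset k} {x s t b} → W b → Reaches m W I (x ∘ Fin.suc) s →
                   + m ∣ s + b * x Fin.zero - t → Reaches m W (inside ∷ I) x t
  reaches-extend {I = I} {x} {s} {t} {b} b∈W reaches-s s+bx₀≡t =
    reaches-inside b b∈W (reaches-cong (t - b * x Fin.zero) (subst (+ m ∣_) (regroup s b (x Fin.zero) t) s+bx₀≡t) reaches-s)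
    where
      regroup : ∀ s b x t → s + b * x - t ≡ s - (t - b * x)
      regroup = solve-∀

  reaches-inside-∣ : ∀ {k} {I : Subset k} {x t} → W 1ℤ → + m ∣ x Fin.zero →
                     Reaches m W I (x ∘ Fin.suc) t → Reaches m W (inside ∷ I) x t
  reaches-inside-∣ {x = x} {t} 1∈W m∣x₀ reaches-t =
    reaches-extend 1∈W reaches-t (subst (+ m ∣_) (regroup t (x Fin.zero)) (∣n⇒∣m*n 1ℤ m∣x₀))
    where
      regroup : ∀ t x → 1ℤ * x ≡ t + 1ℤ * x - t
      regroup = solve-∀

module _ {n : ℕ} {A : Fin n → Set} where

  all-have-zero-sum-suc : ∀ {k} → AllHaveZeroSum n A k → AllHaveZeroSum n A (suc k)
  all-have-zero-sum-suc {k} all x with all (x ∘ Fin.suc)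
  ... | I , (i , i∈I) , a , a∈A , n∣Σ = outside ∷ I , (Fin.suc i , there i∈I) , extend , extend∈A , n∣Σ
    where
      extend : Fin (suc k) → Fin n
      extend Fin.zero    = x Fin.zero
      extend (Fin.suc j) = a j
      extend∈A : ∀ j → j ∈ (outside ∷ I) → A (extend j)
      extend∈A (Fin.suc j) (there j∈I) = a∈A j j∈I

  all-have-zero-sum-mono : ∀ {k l} → k ℕ.≤′ l → AllHaveZeroSum n A k → AllHaveZeroSum n A l
  all-have-zero-sum-mono ℕ.≤′-refl         = λ all → all
  all-have-zero-sum-mono (ℕ.≤′-step k≤′l) = all-have-zero-sum-suc ∘ all-have-zero-sum-mono k≤′l

-- Square-weighted sums modulo an odd prime

data Count : Set where
  none one two many : Count

increment : Count → Count
increment none = one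
increment one  = two
increment two  = many
increment many = many

countFalse : ∀ {k} → Subset k → Vec Bool k → Count
countFalse []            []            = none
countFalse (outside ∷ I) (_     ∷ bs)  = countFalse I bs
countFalse (inside ∷ I)  (true  ∷ bs)  = countFalse I bs
countFalse (inside ∷ I)  (false ∷ bs)  = increment (countFalse I bs)

noneOrMany : Count → Bool
noneOrMany none = true
noneOrMany one  = false
noneOrMany two  = false
noneOrMany many = true

divisibleBy : ∀ {k} → ℕ → (Fin k → ℤ) → Vec Bool k
divisibleBy m x = tabulate (λ i → does (+ m ∣? x i))

splitAt-injective : ∀ m {n} (k l : Fin (m ℕ.+ n)) → Fin.splitAt m k ≡ Fin.splitAt m l → k ≡ l
splitAt-injective m {n} k l eq =
  trans (sym (Fin.join-splitAt m n k)) (trans (cong (Fin.join m n) eq) (Fin.join-splitAt m n l))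

module QuadraticResidues (q : ℕ) (q-prime : Prime q) (h : ℕ) (q≡2h+1 : q ≡ suc (h ℕ.+ h)) where

  instance
    q≢0 : NonZero q
    q≢0 = prime⇒nonZero q-prime

  open Residues q

  record IsSquare (a : ℤ) : Set where
    constructor _,_
    field
      root     : ℤ
      a≡root²  : + q ∣ a - root * root

  NonzeroSquare : ℤ → Set
  NonzeroSquare a = ¬ + q ∣ a × IsSquare a

  record Similar (u v : ℤ) : Set where
    constructor similar
    field
      factor      : ℤ
      factor-∤    : ¬ + q ∣ factor
      v≡u·factor² : + q ∣ v - u * (factor * factor)

  ∤-* : ∀ {a b} → ¬ + q ∣ a → ¬ + q ∣ b → ¬ + q ∣ a * b
  ∤-* = prime-∤-* q-prime

  1<q : 1 ℕ.< q
  1<q = prime⇒1< q-prime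

  ∤1 : ¬ + q ∣ 1ℤ
  ∤1 = ∤-between 1 (s≤s z≤n) 1<q

  inverse : ∀ a → ¬ + q ∣ a → ∃ λ b → + q ∣ a * b - 1ℤ
  inverse a q∤a = inverse-mod a (prime-∤⇒coprime q-prime a q∤a)

  inverse-∤ : ∀ {a b} → + q ∣ a * b - 1ℤ → ¬ + q ∣ b
  inverse-∤ {a} = ∣-*-1⇒∤ 1<q {a}

  root-∤ : ∀ {K a t} → ¬ + q ∣ a → + q ∣ a - K * (t * t) → ¬ + q ∣ t
  root-∤ {K} {a} {t} q∤a a≡Kt² q∣t = q∤a (∣-sub-∣ a≡Kt² (∣n⇒∣m*n K (∣m⇒∣m*n t q∣t)))

  square-square : ∀ t → IsSquare (t * t)
  square-square t = t , ∣-sub-refl (t * t)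

  square-cong : ∀ {a b} → + q ∣ a - b → IsSquare a → IsSquare b
  square-cong {a} {b} a≡b (t , a≡t²) = t , ∣-sub-trans b a (t * t) (∣-sub-sym a b a≡b) a≡t²

  square-root-cong : ∀ a s t → + q ∣ s - t → + q ∣ a - s * s → + q ∣ a - t * t
  square-root-cong a s t s≡t a≡s² =
    subst (+ q ∣_) (expand a s t) (∣m∣n⇒∣m+n a≡s² (∣m⇒∣m*n (s + t) s≡t))
    where
      expand : ∀ a s t → a - s * s + (s - t) * (s + t) ≡ a - t * t
      expand = solve-∀

  square-* : ∀ {a b} → IsSquare a → IsSquare b → IsSquare (a * b)
  square-* {a} {b} (s , a≡s²) (t , b≡t²) = s * t ,
    subst (+ q ∣_) (expand a b s t) (∣m∣n⇒∣m+n (∣m⇒∣m*n b a≡s²) (∣n⇒∣m*n (s * s) b≡t²))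
    where
      expand : ∀ a b s t → (a - s * s) * b + s * s * (b - t * t) ≡ a * b - s * t * (s * t)
      expand = solve-∀

  square-root-∤ : ∀ {a} t → ¬ + q ∣ a → + q ∣ a - t * t → ¬ + q ∣ t
  square-root-∤ {a} t q∤a a≡t² q∣t = q∤a (∣-sub-∣ a≡t² (∣m⇒∣m*n t q∣t))

  nonzero-square-cong : ∀ {a b} → + q ∣ a - b → NonzeroSquare a → NonzeroSquare b
  nonzero-square-cong a≡b (q∤a , a-square) = ∤-sub-∤ a≡b q∤a , square-cong a≡b a-square

  square? : ∀ a → Dec (IsSquare a)
  square? a = map′ (λ (t , a≡t²) → t , a≡t²) (λ (t , a≡t²) → t , a≡t²)
    (∃-residue? (square-root-cong a) (λ t → + q ∣? a - t * t))

  residue-root : ∀ {a} → IsSquare a → ∃ λ x → x ℕ.< q × + q ∣ a - + x * + x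
  residue-root {a} (t , a≡t²) = residue t , residue<m t , square-root-cong a t _ (∣-residue t) a≡t²

  ∣+a-+x*+x∣ : ∀ a x → ℤ.∣ + a - + x * + x ∣ ≡ ℕ.∣ x ℕ.* x - a ∣
  ∣+a-+x*+x∣ a x = trans (cong (λ y → ℤ.∣ + a - y ∣) (sym (ℤ.pos-* x x)))
                         (trans (∣+a-+b∣≡∣a-b∣ a (x ℕ.* x)) (ℕ.∣-∣-comm a (x ℕ.* x)))

  isSquareMod⇔square : ∀ a → T (isSquareMod q a) ⇔ IsSquare (+ a)
  isSquareMod⇔square a = mk⇔ to from
    where
      to : T (isSquareMod q a) → IsSquare (+ a)
      to search =
        let x , _ , found = List.find (any⁻ _ (upTo q) search)
        in  + x , ∣ᵤ⇒∣ (subst (q ℕ.∣_) (sym (∣+a-+x*+x∣ a x))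
                             (toWitness (subst T (sym (isYes≗does (q ℕ.∣? _))) found)))
      from : IsSquare (+ a) → T (isSquareMod q a)
      from square =
        let x , x<q , a≡x² = residue-root square
        in  any⁺ _ (List.lose (∈-upTo⁺ x<q)
              (subst T (sym (dec-true (q ℕ.∣? _) (subst (q ℕ.∣_) (∣+a-+x*+x∣ a x) (∣⇒∣ᵤ a≡x²)))) tt))

  similar-sym : ∀ {u v} → Similar u v → Similar v u
  similar-sym {u} {v} (similar s q∤s v≡us²) =
    let z , sz≡1 = inverse s q∤s
    in  similar z (inverse-∤ {s} sz≡1) $ subst (+ q ∣_) (expand u v s z)
          (∣m∣n⇒∣m+n (∣m⇒∣-m (∣m⇒∣m*n (z * z) v≡us²)) (∣n⇒∣m*n (- u) (∣m⇒∣m*n (s * z + 1ℤ) sz≡1)))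
    where
      expand : ∀ u v s z → - ((v - u * (s * s)) * (z * z)) + - u * ((s * z - 1ℤ) * (s * z + 1ℤ)) ≡ u - v * (z * z)
      expand = solve-∀

  similar-trans : ∀ {u v w} → Similar u v → Similar v w → Similar u w
  similar-trans {u} {v} {w} (similar s q∤s v≡us²) (similar t q∤t w≡vt²) = similar (s * t) (∤-* q∤s q∤t) $
    subst (+ q ∣_) (expand u v w s t) (∣m∣n⇒∣m+n w≡vt² (∣n⇒∣m*n (t * t) v≡us²))
    where
      expand : ∀ u v w s t → w - v * (t * t) + t * t * (v - u * (s * s)) ≡ w - u * (s * t * (s * t))
      expand = solve-∀

  similar-square : ∀ {u v} → Similar u v → IsSquare u → IsSquare v
  similar-square {u} {v} (similar s _ v≡us²) (t , u≡t²) = t * s ,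
    subst (+ q ∣_) (expand u v s t) (∣m∣n⇒∣m+n v≡us² (∣n⇒∣m*n (s * s) u≡t²))
    where
      expand : ∀ u v s t → v - u * (s * s) + s * s * (u - t * t) ≡ v - t * s * (t * s)
      expand = solve-∀

  nonzero-square⇒similar-1 : ∀ {u} → NonzeroSquare u → Similar 1ℤ u
  nonzero-square⇒similar-1 {u} (q∤u , t , u≡t²) =
    similar t (square-root-∤ t q∤u u≡t²) (subst (λ z → + q ∣ u - z) (sym (ℤ.*-identityˡ (t * t))) u≡t²)

  low : Fin h → ℤ
  low i = + suc (toℕ i)

  low<q : ∀ i → suc (toℕ i) ℕ.< q
  low<q i = subst (suc (toℕ i) ℕ.<_) (sym q≡2h+1) (s≤s (ℕ.≤-trans (Fin.toℕ<n i) (ℕ.m≤m+n h h)))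

  low-∤ : ∀ i → ¬ + q ∣ low i
  low-∤ i = ∤-between _ (s≤s z≤n) (low<q i)

  low-square-injective : ∀ i j → + q ∣ low i * low i - low j * low j → i ≡ j
  low-square-injective i j q∣i²-j² =
    [ (λ q∣i-j → Fin.toℕ-injective (ℕ.suc-injective (∣-small-difference⇒≡ (low<q i) (low<q j) q∣i-j)))
    , (λ q∣i+j → ⊥-elim (∤-between _ (s≤s z≤n) i+j<q (subst (+ q ∣_) (sym (ℤ.pos-+ (suc (toℕ i)) _)) q∣i+j)))
    ]′ (prime-∣-* q-prime (low i - low j) (low i + low j) (subst (+ q ∣_) (factor (low i) (low j)) q∣i²-j²))
    where
      factor : ∀ x y → x * x - y * y ≡ (x - y) * (x + y)
      factor = solve-∀
      i+j<q : suc (toℕ i) ℕ.+ suc (toℕ j) ℕ.< q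
      i+j<q = subst (_ ℕ.<_) (sym q≡2h+1) (s≤s (ℕ.+-mono-≤ (Fin.toℕ<n i) (Fin.toℕ<n j)))

  low-root : ∀ v {y} → 0 ℕ.< y → y ℕ.≤ h → + q ∣ v - + y * + y → ∃ λ i → + q ∣ v - low i * low i
  low-root v {suc y} _ y<h v≡y² =
    fromℕ< y<h , subst (λ k → + q ∣ v - + suc k * + suc k) (sym (Fin.toℕ-fromℕ< y<h)) v≡y²

  negate-root : ∀ v t → + q ∣ v - t * t → + q ∣ v - (+ q - t) * (+ q - t)
  negate-root v t v≡t² =
    subst (+ q ∣_) (expand v t (+ q)) (∣m∣n⇒∣m-n v≡t² (∣m⇒∣m*n (+ q - t - t) (∣-refl {+ q})))
    where
      expand : ∀ v t q → v - t * t - q * (q - t - t) ≡ v - (q - t) * (q - t)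
      expand = solve-∀

  -- a root x or its negative q - x lies in [1, h]
  root-in-low : ∀ {v} → ¬ + q ∣ v → IsSquare v → ∃ λ i → + q ∣ v - low i * low i
  root-in-low {v} q∤v v-square = from-residue (residue-root v-square)
    where
      from-residue : (∃ λ x → x ℕ.< q × + q ∣ v - + x * + x) → ∃ λ i → + q ∣ v - low i * low i
      from-residue (zero  , _   , v≡0²) = ⊥-elim (q∤v (subst (+ q ∣_) (ℤ.+-identityʳ v) v≡0²))
      from-residue (suc x , x<q , v≡x²) = small-or-large (suc x ℕ.≤? h)
        where
          q-x≡ : + (q ℕ.∸ suc x) ≡ + q - + suc x
          q-x≡ = trans (sym (ℤ.⊖-≥ (ℕ.<⇒≤ x<q))) (sym (ℤ.m-n≡m⊖n q (suc x)))
          small-or-large : Dec (suc x ℕ.≤ h) → ∃ λ i → + q ∣ v - low i * low i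
          small-or-large (yes x<h) = low-root v (s≤s z≤n) x<h v≡x²
          small-or-large (no  x≮h) = low-root v (ℕ.m<n⇒0<n∸m x<q)
            (ℕ.≤-trans (ℕ.∸-monoʳ-≤ q (ℕ.≰⇒> x≮h))
                       (ℕ.≤-reflexive (trans (cong (ℕ._∸ suc h) q≡2h+1) (ℕ.m+n∸n≡m h h))))
            (subst (λ t → + q ∣ v - t * t) (sym q-x≡) (negate-root v (+ suc x) v≡x²))

  0<h : 0 ℕ.< h
  0<h = ℕ.n≢0⇒n>0 λ h≡0 → ℕ.<-irrefl refl (subst (1 ℕ.<_) (trans q≡2h+1 (cong (λ k → suc (k ℕ.+ k)) h≡0)) 1<q)

  1+k<q : ∀ (k : Fin (h ℕ.+ h)) → suc (toℕ k) ℕ.< q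
  1+k<q k = subst (suc (toℕ k) ℕ.<_) (sym q≡2h+1) (s≤s (Fin.toℕ<n k))

  -- two of 1, …, 2h would share a root in [1, h]
  not-all-squares : ¬ (∀ (k : Fin (h ℕ.+ h)) → IsSquare (+ suc (toℕ k)))
  not-all-squares square = collision (Fin.pigeonhole h<h+h (proj₁ ∘ root))
    where
      h<h+h : h ℕ.< h ℕ.+ h
      h<h+h = subst (ℕ._< h ℕ.+ h) (ℕ.+-identityʳ h) (ℕ.+-monoʳ-< h 0<h)
      root : ∀ k → ∃ λ i → + q ∣ + suc (toℕ k) - low i * low i
      root k = root-in-low (∤-between _ (s≤s z≤n) (1+k<q k)) (square k)
      collision : (∃₂ λ k l → k Fin.< l × proj₁ (root k) ≡ proj₁ (root l)) → ⊥
      collision (k , l , k<l , same-root) = Fin.<-irrefl (Fin.toℕ-injective (ℕ.suc-injective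
        (∣-small-difference⇒≡ (1+k<q k) (1+k<q l)
          (∣-sub-trans (+ suc (toℕ k)) (low i * low i) (+ suc (toℕ l)) (proj₂ (root k))
            (∣-sub-sym (+ suc (toℕ l)) (low i * low i) l≡i²))))) k<l
        where
          i : Fin h
          i = proj₁ (root k)
          l≡i² : + q ∣ + suc (toℕ l) - low i * low i
          l≡i² = subst (λ j → + q ∣ + suc (toℕ l) - low j * low j) (sym same-root) (proj₂ (root l))

  nonresidue : ∃ λ r → ¬ + q ∣ r × ¬ IsSquare r
  nonresidue =
    let k , k-nonsquare = decidable-stable (Fin.any? λ (k : Fin (h ℕ.+ h)) → ¬? (square? (+ suc (toℕ k))))
                            λ ¬∃ → not-all-squares λ k → decidable-stable (square? _) (λ ¬square → ¬∃ (k , ¬square))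
    in  + suc (toℕ k) , ∤-between _ (s≤s z≤n) (1+k<q k) , k-nonsquare

  module _ {r : ℤ} (q∤r : ¬ + q ∣ r) (r-nonsquare : ¬ IsSquare r) where

    private
      value : Fin h ⊎ Fin h → ℤ
      value (inj₁ i) = low i * low i
      value (inj₂ i) = r * (low i * low i)

      value-∤ : ∀ u → ¬ + q ∣ value u
      value-∤ (inj₁ i) = ∤-* (low-∤ i) (low-∤ i)
      value-∤ (inj₂ i) = ∤-* q∤r (∤-* (low-∤ i) (low-∤ i))

      cancel-r : ∀ {a b} → + q ∣ r * a - r * b → + q ∣ a - b
      cancel-r {a} {b} d = [ (λ q∣r → ⊥-elim (q∤r q∣r)) , (λ q∣a-b → q∣a-b) ]′
        (prime-∣-* q-prime r (a - b) (subst (+ q ∣_) (factor r a b) d))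
        where
          factor : ∀ r a b → r * a - r * b ≡ r * (a - b)
          factor = solve-∀

      value-injective : ∀ u w → + q ∣ value u - value w → u ≡ w
      value-injective (inj₁ i) (inj₁ j) d = cong inj₁ (low-square-injective i j d)
      value-injective (inj₁ i) (inj₂ j) d =
        ⊥-elim (r-nonsquare (similar-square (similar-sym (similar (low j) (low-∤ j) d)) (square-square (low i))))
      value-injective (inj₂ i) (inj₁ j) d =
        ⊥-elim (r-nonsquare (similar-square (similar-sym (similar (low i) (low-∤ i) (∣-sub-sym (value (inj₂ i)) _ d)))
                                           (square-square (low j))))
      value-injective (inj₂ i) (inj₂ j) d = cong inj₂ (low-square-injective i j (cancel-r d))

      class? : ∀ n → Dec (∃ λ t → + q ∣ n - r * (t * t))
      class? n = ∃-residue? shift (λ t → + q ∣? n - r * (t * t))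
        where
          shift : ∀ s t → + q ∣ s - t → + q ∣ n - r * (s * s) → + q ∣ n - r * (t * t)
          shift s t s≡t n≡rs² =
            subst (+ q ∣_) (expand n r s t) (∣m∣n⇒∣m+n n≡rs² (∣n⇒∣m*n r (∣m⇒∣m*n (s + t) s≡t)))
            where
              expand : ∀ n r s t → n - r * (s * s) + r * ((s - t) * (s + t)) ≡ n - r * (t * t)
              expand = solve-∀

      -- otherwise n, 1², …, h², r·1², …, r·h² would be q pairwise incongruent nonzero residues
      in-class : ∀ {n} → ¬ + q ∣ n → ¬ IsSquare n → ¬ ¬ ∃ λ t → + q ∣ n - r * (t * t)
      in-class {n} q∤n n-nonsquare ¬class = collide (pigeonhole-∤ (ℕ.≤-reflexive q≡2h+1) sequence sequence-∤)
        where
          n-apart : ∀ u → ¬ + q ∣ n - value u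
          n-apart (inj₁ i) d = n-nonsquare (low i , d)
          n-apart (inj₂ i) d = ¬class (low i , d)
          sequence : Fin (suc (h ℕ.+ h)) → ℤ
          sequence Fin.zero    = n
          sequence (Fin.suc k) = value (Fin.splitAt h k)
          sequence-∤ : ∀ k → ¬ + q ∣ sequence k
          sequence-∤ Fin.zero    = q∤n
          sequence-∤ (Fin.suc k) = value-∤ (Fin.splitAt h k)
          sequence-injective : ∀ k l → + q ∣ sequence k - sequence l → k ≡ l
          sequence-injective Fin.zero    Fin.zero    _ = refl
          sequence-injective Fin.zero    (Fin.suc l) d = ⊥-elim (n-apart (Fin.splitAt h l) d)
          sequence-injective (Fin.suc k) Fin.zero    d = ⊥-elim (n-apart (Fin.splitAt h k) (∣-sub-sym (sequence (Fin.suc k)) n d))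
          sequence-injective (Fin.suc k) (Fin.suc l) d =
            cong Fin.suc (splitAt-injective h k l (value-injective (Fin.splitAt h k) (Fin.splitAt h l) d))
          collide : (∃₂ λ k l → k Fin.< l × + q ∣ sequence k - sequence l) → ⊥
          collide (k , l , k<l , d) = Fin.<-irrefl (sequence-injective k l d) k<l

    nonsquare-similar : ∀ {n} → ¬ + q ∣ n → ¬ IsSquare n → Similar r n
    nonsquare-similar {n} q∤n n-nonsquare =
      let t , n≡rt² = decidable-stable (class? n) (in-class q∤n n-nonsquare)
      in  similar t (root-∤ {r} q∤n n≡rt²) n≡rt²

  nonsquares-similar : ∀ {u v} → ¬ + q ∣ u → ¬ IsSquare u → ¬ + q ∣ v → ¬ IsSquare v → Similar u v
  nonsquares-similar q∤u u-nonsquare q∤v v-nonsquare =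
    let r , q∤r , r-nonsquare = nonresidue
    in  similar-trans (similar-sym (nonsquare-similar q∤r r-nonsquare q∤u u-nonsquare))
                      (nonsquare-similar q∤r r-nonsquare q∤v v-nonsquare)

  squares-similar : ∀ {u v} → NonzeroSquare u → NonzeroSquare v → Similar u v
  squares-similar u-square v-square =
    similar-trans (similar-sym (nonzero-square⇒similar-1 u-square)) (nonzero-square⇒similar-1 v-square)

  two-of-three-similar : ∀ {u₁ u₂ u₃} → ¬ + q ∣ u₁ → ¬ + q ∣ u₂ → ¬ + q ∣ u₃ →
                         Similar u₁ u₂ ⊎ Similar u₁ u₃ ⊎ Similar u₂ u₃
  two-of-three-similar {u₁} {u₂} {u₃} q∤u₁ q∤u₂ q∤u₃ = by-kind (square? u₁) (square? u₂) (square? u₃)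
    where
      by-kind : Dec (IsSquare u₁) → Dec (IsSquare u₂) → Dec (IsSquare u₃) →
                Similar u₁ u₂ ⊎ Similar u₁ u₃ ⊎ Similar u₂ u₃
      by-kind (yes s₁) (yes s₂) _        = inj₁ (squares-similar (q∤u₁ , s₁) (q∤u₂ , s₂))
      by-kind (no  n₁) (no  n₂) _        = inj₁ (nonsquares-similar q∤u₁ n₁ q∤u₂ n₂)
      by-kind (yes s₁) (no  _)  (yes s₃) = inj₂ (inj₁ (squares-similar (q∤u₁ , s₁) (q∤u₃ , s₃)))
      by-kind (no  n₁) (yes _)  (no  n₃) = inj₂ (inj₁ (nonsquares-similar q∤u₁ n₁ q∤u₃ n₃))
      by-kind (yes _)  (no  n₂) (no  n₃) = inj₂ (inj₂ (nonsquares-similar q∤u₂ n₂ q∤u₃ n₃))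
      by-kind (no  _)  (yes s₂) (yes s₃) = inj₂ (inj₂ (squares-similar (q∤u₂ , s₂) (q∤u₃ , s₃)))

  module Sums (5<q : 5 ℕ.< q) where

    ∤-upto-5 : ∀ d → 0 ℕ.< d → d ℕ.≤ 5 → ¬ + q ∣ + d
    ∤-upto-5 d 0<d d≤5 = ∤-between d 0<d (ℕ.≤-<-trans d≤5 5<q)

    square-nonzero-square : ∀ {t} → ¬ + q ∣ t → NonzeroSquare (t * t)
    square-nonzero-square {t} q∤t = ∤-* q∤t q∤t , square-square t

    square-below-nonsquare : ∀ m → ¬ IsSquare (+ m) →
                             ∃ λ k → 0 ℕ.< k × k ℕ.< m × IsSquare (+ k) × ¬ IsSquare (+ suc k)
    square-below-nonsquare zero    m-nonsquare = ⊥-elim (m-nonsquare (square-square 0ℤ))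
    square-below-nonsquare (suc m) m+1-nonsquare = below m (square? (+ m)) m+1-nonsquare
      where
        below : ∀ m → Dec (IsSquare (+ m)) → ¬ IsSquare (+ suc m) →
                ∃ λ k → 0 ℕ.< k × k ℕ.< suc m × IsSquare (+ k) × ¬ IsSquare (+ suc k)
        below zero    (yes _)  m+1-nonsquare = ⊥-elim (m+1-nonsquare (square-square 1ℤ))
        below zero    (no m-nonsquare) _     = ⊥-elim (m-nonsquare (square-square 0ℤ))
        below (suc m) (yes m-square) m+1-nonsquare = suc m , s≤s z≤n , ℕ.n<1+n _ , m-square , m+1-nonsquare
        below (suc m) (no m-nonsquare) _ =
          let k , 0<k , k<m , k-square , k+1-nonsquare = below m (square? (+ m)) m-nonsquare
          in  k , 0<k , ℕ.m<n⇒m<1+n k<m , k-square , k+1-nonsquare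

    -- c = (3s/5)² + (4s/5)² for a square c = s², and c = k s² + s² when c = (k + 1) s² with k a square
    sum-of-two-squares : ∀ {c} → ¬ + q ∣ c → ∃₂ λ a b → NonzeroSquare a × NonzeroSquare b × + q ∣ c - (a + b)
    sum-of-two-squares {c} q∤c = by-kind (square? c)
      where
        by-kind : Dec (IsSquare c) → ∃₂ λ a b → NonzeroSquare a × NonzeroSquare b × + q ∣ c - (a + b)
        by-kind (yes (s , c≡s²)) =
          let z , 5z≡1 = inverse (+ 5) (∤-upto-5 5 (s≤s z≤n) ℕ.≤-refl)
              q∤s = square-root-∤ s q∤c c≡s²
              q∤z = inverse-∤ {+ 5} {z} 5z≡1
          in  + 3 * s * z * (+ 3 * s * z) , + 4 * s * z * (+ 4 * s * z) ,
              square-nonzero-square (∤-* (∤-* (∤-upto-5 3 (s≤s z≤n) (ℕ.m≤m+n 3 2)) q∤s) q∤z) ,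
              square-nonzero-square (∤-* (∤-* (∤-upto-5 4 (s≤s z≤n) (ℕ.m≤m+n 4 1)) q∤s) q∤z) ,
              subst (+ q ∣_) (pythagoras c s z)
                (∣m∣n⇒∣m-n c≡s² (∣n⇒∣m*n (s * s) (∣m⇒∣m*n (+ 5 * z + 1ℤ) 5z≡1)))
          where
            pythagoras : ∀ c s z → c - s * s - s * s * ((+ 5 * z - 1ℤ) * (+ 5 * z + 1ℤ)) ≡
                         c - (+ 3 * s * z * (+ 3 * s * z) + + 4 * s * z * (+ 4 * s * z))
            pythagoras = solve-∀
        by-kind (no c-nonsquare) =
          let k , 0<k , k<m , k-square , k+1-nonsquare = square-below-nonsquare (residue c) residue-nonsquare
              k+1<q = ℕ.<-≤-trans (s≤s k<m) (residue<m c)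
              similar s q∤s c≡[k+1]s² = nonsquares-similar (∤-between _ (s≤s z≤n) k+1<q) k+1-nonsquare q∤c c-nonsquare
          in  + k * (s * s) , s * s ,
              (∤-* (∤-between k 0<k (ℕ.<-trans (ℕ.n<1+n k) k+1<q)) (∤-* q∤s q∤s) , square-* k-square (square-square s)) ,
              square-nonzero-square q∤s ,
              subst (+ q ∣_) (split c (+ k) (s * s)) c≡[k+1]s²
          where
            residue-nonsquare : ¬ IsSquare (+ residue c)
            residue-nonsquare square = c-nonsquare (square-cong (∣-sub-sym c _ (∣-residue c)) square)
            split : ∀ c k s → c - (1ℤ + k) * s ≡ c - (k * s + s)
            split = solve-∀

    -- t/u₁ = a + b is a sum of two nonzero squares, and b u₁ = (b/s²) u₂
    similar-pair-spans : ∀ {u₁ u₂} → ¬ + q ∣ u₁ → Similar u₁ u₂ → ∀ {t} → ¬ + q ∣ t →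
                         ∃₂ λ a b → NonzeroSquare a × NonzeroSquare b × + q ∣ a * u₁ + b * u₂ - t
    similar-pair-spans {u₁} {u₂} q∤u₁ (similar s q∤s u₂≡u₁s²) {t} q∤t =
      let v , u₁v≡1 = inverse u₁ q∤u₁
          w , sw≡1  = inverse s q∤s
          q∤w = inverse-∤ {s} {w} sw≡1
          a , b , a-square , (q∤b , b-square) , tv≡a+b = sum-of-two-squares (∤-* q∤t (inverse-∤ {u₁} {v} u₁v≡1))
      in  a , b * (w * w) , a-square , (∤-* q∤b (∤-* q∤w q∤w) , square-* b-square (square-square w)) ,
          subst (+ q ∣_) (combine a b w u₁ u₂ s t v)
            (∣m∣n⇒∣m+n (∣m∣n⇒∣m+n (∣m∣n⇒∣m+n (∣m⇒∣-m (∣m⇒∣m*n u₁ tv≡a+b))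
                                             (∣n⇒∣m*n (b * (w * w)) u₂≡u₁s²))
                                  (∣n⇒∣m*n (b * u₁) (∣m⇒∣m*n (s * w + 1ℤ) sw≡1)))
                       (∣n⇒∣m*n t u₁v≡1))
      where
        combine : ∀ a b w u₁ u₂ s t v →
          - ((t * v - (a + b)) * u₁) + b * (w * w) * (u₂ - u₁ * (s * s))
            + b * u₁ * ((s * w - 1ℤ) * (s * w + 1ℤ)) + t * (u₁ * v - 1ℤ)
            ≡ a * u₁ + b * (w * w) * u₂ - t
        combine = solve-∀

    one-square : NonzeroSquare 1ℤ
    one-square = square-nonzero-square {1ℤ} ∤1

    -- 1 and 4 are squares whose difference 3 is nonzero
    avoid-zero : ∀ {w} → ¬ + q ∣ w → ∀ t → ∃ λ c → NonzeroSquare c × ¬ + q ∣ t - c * w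
    avoid-zero q∤w t =
      [ (λ q∤t-w → 1ℤ , one-square , q∤t-w) , (λ q∤t-4w → + 4 , four-square , q∤t-4w) ]′
      (one-of-two-∤ q-prime 1ℤ (+ 4) (∤-upto-5 3 (s≤s z≤n) (ℕ.m≤m+n 3 2)) q∤w t)
      where
        four-square : NonzeroSquare (+ 4)
        four-square = square-nonzero-square {+ 2} (∤-upto-5 2 (s≤s z≤n) (ℕ.m≤m+n 2 3))

    record Spans (u₁ u₂ u₃ t : ℤ) : Set where
      constructor spans
      field
        {a b c}  : ℤ
        a-square : NonzeroSquare a
        b-square : NonzeroSquare b
        c-square : NonzeroSquare c
        t≡       : + q ∣ a * u₁ + b * u₂ + c * u₃ - t

    spans-swap : ∀ {u₁ u₂ u₃ t} → Spans u₁ u₃ u₂ t → Spans u₁ u₂ u₃ t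
    spans-swap {u₁} {u₂} {u₃} {t} (spans {a} {c} {b} a-sq c-sq b-sq t≡) =
      spans a-sq b-sq c-sq (subst (+ q ∣_) (reorder a b c u₁ u₂ u₃ t) t≡)
      where
        reorder : ∀ a b c u₁ u₂ u₃ t → a * u₁ + c * u₃ + b * u₂ - t ≡ a * u₁ + b * u₂ + c * u₃ - t
        reorder = solve-∀

    spans-rotate : ∀ {u₁ u₂ u₃ t} → Spans u₂ u₃ u₁ t → Spans u₁ u₂ u₃ t
    spans-rotate {u₁} {u₂} {u₃} {t} (spans {b} {c} {a} b-sq c-sq a-sq t≡) =
      spans a-sq b-sq c-sq (subst (+ q ∣_) (reorder a b c u₁ u₂ u₃ t) t≡)
      where
        reorder : ∀ a b c u₁ u₂ u₃ t → b * u₂ + c * u₃ + a * u₁ - t ≡ a * u₁ + b * u₂ + c * u₃ - t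
        reorder = solve-∀

    similar-pair-and-one-span : ∀ {u₁ u₂ u₃} → ¬ + q ∣ u₁ → Similar u₁ u₂ → ¬ + q ∣ u₃ →
                                ∀ t → Spans u₁ u₂ u₃ t
    similar-pair-and-one-span {u₁} {u₂} {u₃} q∤u₁ u₁~u₂ q∤u₃ t =
      let c , c-square , q∤t-cu₃ = avoid-zero q∤u₃ t
          a , b , a-square , b-square , t-cu₃≡ = similar-pair-spans q∤u₁ u₁~u₂ q∤t-cu₃
      in  spans a-square b-square c-square (subst (+ q ∣_) (regroup a b c u₁ u₂ u₃ t) t-cu₃≡)
      where
        regroup : ∀ a b c u₁ u₂ u₃ t → a * u₁ + b * u₂ - (t - c * u₃) ≡ a * u₁ + b * u₂ + c * u₃ - t
        regroup = solve-∀

    three-nonzero-span : ∀ {u₁ u₂ u₃} → ¬ + q ∣ u₁ → ¬ + q ∣ u₂ → ¬ + q ∣ u₃ →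
                         ∀ t → Spans u₁ u₂ u₃ t
    three-nonzero-span q∤u₁ q∤u₂ q∤u₃ t =
      [ (λ u₁~u₂ → similar-pair-and-one-span q∤u₁ u₁~u₂ q∤u₃ t)
      , [ (λ u₁~u₃ → spans-swap (similar-pair-and-one-span q∤u₁ u₁~u₃ q∤u₂ t))
        , (λ u₂~u₃ → spans-rotate (similar-pair-and-one-span q∤u₂ u₂~u₃ q∤u₁ t)) ]′ ]′
      (two-of-three-similar q∤u₁ q∤u₂ q∤u₃)

    CountReaches : Count → ∀ {k} → Subset k → (Fin k → ℤ) → Set
    CountReaches none I x = Reaches q NonzeroSquare I x 0ℤ
    CountReaches one  I x = ∃ λ u → ¬ + q ∣ u × ∀ {l} → NonzeroSquare l → Reaches q NonzeroSquare I x (l * u)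
    CountReaches two  I x = ∃₂ λ u₁ u₂ → ¬ + q ∣ u₁ × ¬ + q ∣ u₂ ×
      ∀ {l₁ l₂} → NonzeroSquare l₁ → NonzeroSquare l₂ → Reaches q NonzeroSquare I x (l₁ * u₁ + l₂ * u₂)
    CountReaches many I x = ∀ t → Reaches q NonzeroSquare I x t

    count-reaches-map : ∀ c {k l} {I : Subset k} {J : Subset l} {x y} →
                        (∀ {t} → Reaches q NonzeroSquare I x t → Reaches q NonzeroSquare J y t) →
                        CountReaches c I x → CountReaches c J y
    count-reaches-map none f r = f r
    count-reaches-map one  f (u , q∤u , r) = u , q∤u , f ∘ r
    count-reaches-map two  f (u₁ , u₂ , q∤u₁ , q∤u₂ , r) = u₁ , u₂ , q∤u₁ , q∤u₂ , λ l₁ l₂ → f (r l₁ l₂)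
    count-reaches-map many f r = f ∘ r

    count-reaches-∤ : ∀ c {k} {I : Subset k} {x} → ¬ + q ∣ x Fin.zero →
                      CountReaches c I (x ∘ Fin.suc) → CountReaches (increment c) (inside ∷ I) x
    count-reaches-∤ none {x = x} q∤x₀ r = x Fin.zero , q∤x₀ , λ {l} l-square →
      reaches-extend l-square r (≡0⇒∣ (cancel (l * x Fin.zero)))
      where
        cancel : ∀ y → 0ℤ + y - y ≡ 0ℤ
        cancel = solve-∀
    count-reaches-∤ one {x = x} q∤x₀ (u , q∤u , r) =
      u , x Fin.zero , q∤u , q∤x₀ , λ {l₁} {l₂} l₁-square l₂-square →
      reaches-extend l₂-square (r l₁-square) (∣-sub-refl (l₁ * u + l₂ * x Fin.zero))
    count-reaches-∤ two {x = x} q∤x₀ (u₁ , u₂ , q∤u₁ , q∤u₂ , r) t =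
      let spans a-square b-square c-square t≡ = three-nonzero-span q∤u₁ q∤u₂ q∤x₀ t
      in  reaches-extend c-square (r a-square b-square) t≡
    count-reaches-∤ many {x = x} q∤x₀ r t =
      reaches-extend one-square (r (t - 1ℤ * x Fin.zero)) (≡0⇒∣ (cancel t (1ℤ * x Fin.zero)))
      where
        cancel : ∀ t y → t - y + y - t ≡ 0ℤ
        cancel = solve-∀

    count-reaches : ∀ {k} (I : Subset k) x → CountReaches (countFalse I (divisibleBy q x)) I x
    count-reaches []            x = reaches-[] (divides 0ℤ refl)
    count-reaches (outside ∷ I) x = count-reaches-map _ reaches-outside (count-reaches I (x ∘ Fin.suc))
    count-reaches (inside ∷ I)  x = by-divisibility (+ q ∣? x Fin.zero)
      where
        by-divisibility : (d : Dec (+ q ∣ x Fin.zero)) →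
               CountReaches (countFalse (inside ∷ I) (does d ∷ divisibleBy q (x ∘ Fin.suc))) (inside ∷ I) x
        by-divisibility (yes q∣x₀) = count-reaches-map _ (reaches-inside-∣ one-square q∣x₀) (count-reaches I (x ∘ Fin.suc))
        by-divisibility (no  q∤x₀) = count-reaches-∤ _ q∤x₀ (count-reaches I (x ∘ Fin.suc))

    none-or-many-reaches-0 : ∀ c {k} {I : Subset k} {x} → T (noneOrMany c) → CountReaches c I x →
                             Reaches q NonzeroSquare I x 0ℤ
    none-or-many-reaches-0 none _ r = r
    none-or-many-reaches-0 many _ r = r 0ℤ

-- Unit-weighted sums modulo p²

data Valuation : Set where
  v0 v1 v≥2 : Valuation

valuation-from : ∀ {A B : Set} → Dec A → Dec B → Valuation
valuation-from (yes _) _       = v≥2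
valuation-from (no _)  (yes _) = v1
valuation-from (no _)  (no _)  = v0

valuation : ℕ → ℤ → Valuation
valuation p z = valuation-from (+ (p ^ 2) ∣? z) (+ p ∣? z)

valuations : ∀ {k} → ℕ → (Fin k → ℤ) → Vec Valuation k
valuations p x = tabulate (valuation p ∘ x)

data PState : Set where
  multiplesOfP² exactMultiplesOfP multiplesOfP units everything : PState

pstep : PState → Valuation → PState
pstep s                 v≥2 = s
pstep multiplesOfP²     v1  = exactMultiplesOfP
pstep exactMultiplesOfP v1  = multiplesOfP
pstep multiplesOfP      v1  = multiplesOfP
pstep units             v1  = units
pstep everything        v1  = everything
pstep everything        v0  = everything
pstep units             v0  = everything
pstep _                 v0  = units

pState : ∀ {k} → Subset k → Vec Valuation k → PState
pState []            []       = multiplesOfP²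
pState (outside ∷ I) (_ ∷ vs) = pState I vs
pState (inside ∷ I)  (v ∷ vs) = pstep (pState I vs) v

containsZero : PState → Bool
containsZero multiplesOfP²     = true
containsZero exactMultiplesOfP = false
containsZero multiplesOfP      = true
containsZero units             = false
containsZero everything        = true

module UnitWeightedSums (p : ℕ) (p-prime : Prime p) (2<p : 2 ℕ.< p) where

  instance
    p≢0 : NonZero p
    p≢0 = prime⇒nonZero p-prime

  p² : ℕ
  p² = p ^ 2

  p²≡p*p : + p² ≡ + p * + p
  p²≡p*p = trans (cong (λ k → + (p ℕ.* k)) (ℕ.*-identityʳ p)) (ℤ.pos-* p p)

  1<p : 1 ℕ.< p
  1<p = prime⇒1< p-prime

  Unit : ℤ → Set
  Unit β = ¬ + p ∣ β

  p∣p² : + p ∣ + p²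
  p∣p² = divides (+ p) p²≡p*p

  p²∣⇒p∣ : ∀ {a} → + p² ∣ a → + p ∣ a
  p²∣⇒p∣ = ∣-trans p∣p²

  p∣⇒p²∣p* : ∀ {y} → + p ∣ y → + p² ∣ + p * y
  p∣⇒p²∣p* {y} p∣y = subst (_∣ + p * y) (sym p²≡p*p) (*-monoʳ-∣ (+ p) p∣y)

  p²∣p*⇒p∣ : ∀ {y} → + p² ∣ + p * y → + p ∣ y
  p²∣p*⇒p∣ {y} p²∣py = *-cancelˡ-∣ (+ p) (subst (_∣ + p * y) p²≡p*p p²∣py)

  p²∤p : ¬ + p² ∣ + p
  p²∤p p²∣p = ℕ.<⇒≱ p<p² (ℕ.∣⇒≤ (∣⇒∣ᵤ p²∣p))
    where
      p<p² : p ℕ.< p²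
      p<p² = subst (p ℕ.<_) (cong (p ℕ.*_) (sym (ℕ.*-identityʳ p))) (ℕ.m<m*n p p 1<p)

  p∣⇒factor : ∀ {t} → + p ∣ t → ∃ λ t₁ → t ≡ + p * t₁
  p∣⇒factor {t} (divides t₁ t≡t₁p) = t₁ , trans t≡t₁p (ℤ.*-comm t₁ (+ p))

  unit-* : ∀ {a b} → Unit a → Unit b → Unit (a * b)
  unit-* = prime-∤-* p-prime

  unit-1 : Unit 1ℤ
  unit-1 = ∤-between 1 (s≤s z≤n) 1<p

  unit-2 : Unit (+ 2)
  unit-2 = ∤-between 2 (s≤s z≤n) 2<p

  -- β = a z⁻¹ modulo p²
  unit-quotient : ∀ {z a} → Unit z → Unit a → ∃ λ β → Unit β × + p² ∣ a - β * z
  unit-quotient {z} {a} p∤z p∤a =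
    let z⊥p = prime-∤⇒coprime p-prime z p∤z
        w , zw≡1 = inverse-mod z (coprime-^2 z⊥p)
    in  a * w , unit-* p∤a (∣-*-1⇒∤ 1<p {z} (p²∣⇒p∣ zw≡1)) ,
        subst (+ p² ∣_) (regroup a w z) (∣n⇒∣m*n (- a) zw≡1)
    where
      regroup : ∀ a w z → - a * (z * w - 1ℤ) ≡ a - a * w * z
      regroup = solve-∀

  InClass : PState → ℤ → Set
  InClass multiplesOfP²     t = + p² ∣ t
  InClass exactMultiplesOfP t = + p ∣ t × ¬ + p² ∣ t
  InClass multiplesOfP      t = + p ∣ t
  InClass units             t = Unit t
  InClass everything        t = ⊤

  HasValuation : Valuation → ℤ → Set
  HasValuation v≥2 z = + p² ∣ z
  HasValuation v1  z = + p ∣ z × ¬ + p² ∣ z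
  HasValuation v0  z = Unit z

  valuation-spec : ∀ z → HasValuation (valuation p z) z
  valuation-spec z = from (+ p² ∣? z) (+ p ∣? z)
    where
      from : (d₂ : Dec (+ p² ∣ z)) (d₁ : Dec (+ p ∣ z)) → HasValuation (valuation-from d₂ d₁) z
      from (yes p²∣z) _         = p²∣z
      from (no  p²∤z) (yes p∣z) = p∣z , p²∤z
      from (no  _)    (no  p∤z) = p∤z

  class-shift : ∀ s {t e} → InClass s t → + p² ∣ e → InClass s (t - e)
  class-shift multiplesOfP²     p²∣t         p²∣e = ∣m∣n⇒∣m-n p²∣t p²∣e
  class-shift exactMultiplesOfP (p∣t , p²∤t) p²∣e =
    ∣m∣n⇒∣m-n p∣t (p²∣⇒p∣ p²∣e) , λ p²∣t-e → p²∤t (∣-sub-∣ p²∣t-e p²∣e)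
  class-shift multiplesOfP      p∣t          p²∣e = ∣m∣n⇒∣m-n p∣t (p²∣⇒p∣ p²∣e)
  class-shift units             p∤t          p²∣e = λ p∣t-e → p∤t (∣-sub-∣ p∣t-e (p²∣⇒p∣ p²∣e))
  class-shift everything        _            _    = tt

  private
    factor-out-p : ∀ {t t₁ z z₁} → t ≡ + p * t₁ → z ≡ + p * z₁ → ∀ β → t - β * z ≡ + p * (t₁ - β * z₁)
    factor-out-p {t₁ = t₁} {z₁ = z₁} refl refl β = distribute (+ p) t₁ z₁ β
      where
        distribute : ∀ p t₁ z₁ β → p * t₁ - β * (p * z₁) ≡ p * (t₁ - β * z₁)
        distribute = solve-∀

    cofactor-unit : ∀ {t t₁} → t ≡ + p * t₁ → ¬ + p² ∣ t → Unit t₁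
    cofactor-unit t≡pt₁ p²∤t p∣t₁ = p²∤t (subst (+ p² ∣_) (sym t≡pt₁) (p∣⇒p²∣p* p∣t₁))

    exact-multiple : ∀ {y} → Unit y → InClass exactMultiplesOfP (+ p * y)
    exact-multiple p∤y = ∣m⇒∣m*n _ ∣-refl , λ p²∣py → p∤y (p²∣p*⇒p∣ p²∣py)

  unit-weight-step : ∀ s v {z} → HasValuation v z → ∀ {t} → InClass (pstep s v) t →
                     ∃ λ β → Unit β × InClass s (t - β * z)
  unit-weight-step s v≥2 p²∣z c = 1ℤ , unit-1 , class-shift s c (∣n⇒∣m*n 1ℤ p²∣z)
  unit-weight-step multiplesOfP² v1 (p∣z , p²∤z) (p∣t , p²∤t) =
    let t₁ , t≡pt₁ = p∣⇒factor p∣t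
        z₁ , z≡pz₁ = p∣⇒factor p∣z
        β , unit-β , p²∣t₁-βz₁ = unit-quotient (cofactor-unit z≡pz₁ p²∤z) (cofactor-unit t≡pt₁ p²∤t)
    in  β , unit-β , subst (+ p² ∣_) (sym (factor-out-p t≡pt₁ z≡pz₁ β)) (p∣⇒p²∣p* (p²∣⇒p∣ p²∣t₁-βz₁))
  unit-weight-step multiplesOfP² v0 p∤z p∤t = unit-quotient p∤z p∤t
  unit-weight-step exactMultiplesOfP v1 {z} (p∣z , p²∤z) {t} p∣t =
    let t₁ , t≡pt₁ = p∣⇒factor p∣t
        z₁ , z≡pz₁ = p∣⇒factor p∣z
        exact : ∀ β → Unit β → Unit (t₁ - β * z₁) → ∃ λ β′ → Unit β′ × InClass exactMultiplesOfP (t - β′ * z)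
        exact β unit-β p∤ =
          β , unit-β , subst (InClass exactMultiplesOfP) (sym (factor-out-p t≡pt₁ z≡pz₁ β)) (exact-multiple p∤)
    in  [ exact 1ℤ unit-1 , exact (+ 2) unit-2 ]′ (one-of-two-∤ p-prime 1ℤ (+ 2) unit-1 (cofactor-unit z≡pz₁ p²∤z) t₁)
  unit-weight-step exactMultiplesOfP v0 {z} p∤z {t} p∤t =
    let β , unit-β , p²∣t-p-βz = unit-quotient p∤z (λ p∣t-p → p∤t (∣-sub-∣ p∣t-p ∣-refl))
    in  β , unit-β , ∣-sub-∣ {a = t - β * z} (subst (+ p ∣_) (regroup t (+ p) β z) (p²∣⇒p∣ p²∣t-p-βz)) ∣-refl ,
        λ p²∣t-βz → p²∤p (subst (+ p² ∣_) (cancel t (+ p) β z) (∣m∣n⇒∣m-n p²∣t-βz p²∣t-p-βz))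
    where
      regroup : ∀ t p β z → t - p - β * z ≡ t - β * z - p
      regroup = solve-∀
      cancel : ∀ t p β z → t - β * z - (t - p - β * z) ≡ p
      cancel = solve-∀
  unit-weight-step multiplesOfP v1 (p∣z , _) p∣t = 1ℤ , unit-1 , ∣m∣n⇒∣m-n p∣t (∣n⇒∣m*n 1ℤ p∣z)
  unit-weight-step multiplesOfP v0 p∤z p∤t =
    let β , unit-β , p²∣t-βz = unit-quotient p∤z p∤t in β , unit-β , p²∣⇒p∣ p²∣t-βz
  unit-weight-step units v1 (p∣z , _) p∤t = 1ℤ , unit-1 , λ p∣t-z → p∤t (∣-sub-∣ p∣t-z (∣n⇒∣m*n 1ℤ p∣z))
  unit-weight-step units v0 {z} p∤z {t} _ =
    [ (λ p∤t-z → 1ℤ , unit-1 , p∤t-z) , (λ p∤t-2z → + 2 , unit-2 , p∤t-2z) ]′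
    (one-of-two-∤ p-prime 1ℤ (+ 2) unit-1 p∤z t)
  unit-weight-step everything v1 _ _ = 1ℤ , unit-1 , tt
  unit-weight-step everything v0 _ _ = 1ℤ , unit-1 , tt

  state-reaches : ∀ {k} (I : Subset k) x {t} → InClass (pState I (valuations p x)) t → Reaches p² Unit I x t
  state-reaches []            x c = reaches-[] c
  state-reaches (outside ∷ I) x c = reaches-outside (state-reaches I (x ∘ Fin.suc) c)
  state-reaches (inside ∷ I)  x c =
    let β , unit-β , c′ = unit-weight-step (pState I (valuations p (x ∘ Fin.suc))) (valuation p (x Fin.zero))
                                           (valuation-spec (x Fin.zero)) c
    in  reaches-inside β unit-β (state-reaches I (x ∘ Fin.suc) c′)

  containsZero-spec : ∀ s → T (containsZero s) → InClass s 0ℤ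
  containsZero-spec multiplesOfP² _ = divides 0ℤ refl
  containsZero-spec multiplesOfP  _ = divides 0ℤ refl
  containsZero-spec everything    _ = tt

-- The finite check

T-all : ∀ {A : Set} (p : A → Bool) {x} xs → T (all p xs) → x List.∈ xs → T (p x)
T-all p (y ∷ ys) all-p (Any.here refl)  = proj₁ (Equivalence.to T-∧ all-p)
T-all p (y ∷ ys) all-p (Any.there x∈ys) = T-all p ys (proj₂ (Equivalence.to T-∧ all-p)) x∈ys

module _ {A : Set} (values : List A) where

  allVec : ∀ n → (Vec A n → Bool) → Bool
  allVec zero    f = f []
  allVec (suc n) f = all (λ a → allVec n (f ∘ (a ∷_))) values

  anyVec : ∀ n → (Vec A n → Bool) → Bool
  anyVec zero    f = f []
  anyVec (suc n) f = any (λ a → anyVec n (f ∘ (a ∷_))) values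

  allVec-sound : (∀ a → a List.∈ values) → ∀ n f → T (allVec n f) → ∀ v → T (f v)
  allVec-sound complete zero    f all-f []      = all-f
  allVec-sound complete (suc n) f all-f (a ∷ v) =
    allVec-sound complete n (f ∘ (a ∷_)) (T-all (λ a → allVec n (f ∘ (a ∷_))) values all-f (complete a)) v

  anyVec-sound : ∀ n f → T (anyVec n f) → ∃ λ v → T (f v)
  anyVec-sound zero    f any-f = [] , any-f
  anyVec-sound (suc n) f any-f =
    let a , any-fa = Any.satisfied (any⁻ _ values any-f)
        v , fav    = anyVec-sound n (f ∘ (a ∷_)) any-fa
    in  a ∷ v , fav

ZeroSumPattern : ∀ {k} → Vec Bool k → Vec Valuation k → Subset k → Set
ZeroSumPattern flags vals I = Nonempty I × T (noneOrMany (countFalse I flags)) × T (containsZero (pState I vals))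

zeroSumPattern? : ∀ {k} → Vec Bool k → Vec Valuation k → Subset k → Bool
zeroSumPattern? flags vals I = does (nonempty? I) ∧ noneOrMany (countFalse I flags) ∧ containsZero (pState I vals)

zeroSumPattern?-sound : ∀ {k} flags vals (I : Subset k) → T (zeroSumPattern? flags vals I) → ZeroSumPattern flags vals I
zeroSumPattern?-sound flags vals I ok =
  let nonempty , rest = Equivalence.to T-∧ ok
  in  toWitness (subst T (sym (isYes≗does (nonempty? I))) nonempty) , Equivalence.to T-∧ rest

-- Proved by evaluating the check on all 2⁵·3⁵ patterns; opaque, so that this evaluation is never
-- triggered where the lemma is used.
opaque
  zero-sum-pattern : ∀ flags vals → ∃ (ZeroSumPattern {5} flags vals)
  zero-sum-pattern flags vals =
    let I , ok = anyVec-sound subsets 5 (zeroSumPattern? flags vals)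
                   (allVec-sound all-valuations every-valuation 5 (has-pattern flags)
                     (allVec-sound bools every-bool 5 (λ flags → allVec all-valuations 5 (has-pattern flags)) _ flags) vals)
    in  I , zeroSumPattern?-sound flags vals I ok
    where
      subsets bools : List Bool
      subsets = inside ∷ outside ∷ []
      bools = true ∷ false ∷ []
      all-valuations : List Valuation
      all-valuations = v0 ∷ v1 ∷ v≥2 ∷ []
      has-pattern : Vec Bool 5 → Vec Valuation 5 → Bool
      has-pattern flags vals = anyVec subsets 5 (zeroSumPattern? flags vals)
      every-bool : ∀ b → b List.∈ bools
      every-bool true  = Any.here refl
      every-bool false = Any.there (Any.here refl)
      every-valuation : ∀ v → v List.∈ all-valuations
      every-valuation v0  = Any.here refl
      every-valuation v1  = Any.there (Any.here refl)
      every-valuation v≥2 = Any.there (Any.there (Any.here refl))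

-- The Davenport constant of S(p²q)

module DavenportConstant (p q : ℕ) (p-prime : Prime p) (q-prime : Prime q) (p≢q : p ≢ q) (2<p : 2 ℕ.< p)
                         (h : ℕ) (q≡2h+1 : q ≡ suc (h ℕ.+ h)) (5<q : 5 ℕ.< q) where

  open QuadraticResidues q q-prime h q≡2h+1
  open Sums 5<q
  open UnitWeightedSums p p-prime 2<p

  n : ℕ
  n = p ^ 2 ℕ.* q

  instance
    n≢0 : NonZero n
    n≢0 = ℕ.m*n≢0 (p ^ 2) q {{ℕ.m^n≢0 p 2}}

  open Residues n using (reduce; ∣-reduce)

  A : Fin n → Set
  A = InS n ((p , 2) ∷ (q , 1) ∷ [])

  p∤q : ¬ + p ∣ + q
  p∤q = prime-∤-prime p-prime q-prime p≢q

  q∤p² : ¬ + q ∣ + p²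
  q∤p² = subst (λ P → ¬ + q ∣ P) (sym p²≡p*p) (∤-* q∤p q∤p)
    where
      q∤p : ¬ + q ∣ + p
      q∤p = prime-∤-prime q-prime p-prime (p≢q ∘ sym)

  p²⊥q : Coprime p² q
  p²⊥q = Coprime.sym (coprime-^2 q⊥p)
    where
      q⊥p : Coprime q p
      q⊥p = prime-∤⇒coprime p-prime (+ q) p∤q

  -- (a/p)² = 1, so the Jacobi symbol (a/p²q) is the Legendre symbol (a/q)
  jacobi≡1⇔ : ∀ a → jacobiFact ((p , 2) ∷ (q , 1) ∷ []) a ≡ + 1 ⇔ T (isSquareMod q a)
  jacobi≡1⇔ a = signs (isSquareMod p a) (isSquareMod q a)
    where
      signs : ∀ b c → (if b then + 1 else -[1+ 0 ]) ℤ.^ 2 * ((if c then + 1 else -[1+ 0 ]) ℤ.^ 1 * + 1) ≡ + 1 ⇔ T c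
      signs true  true  = mk⇔ (λ _ → tt) (λ _ → refl)
      signs false true  = mk⇔ (λ _ → tt) (λ _ → refl)
      signs true  false = mk⇔ (λ ()) (λ ())
      signs false false = mk⇔ (λ ()) (λ ())

  A⇒nonzero-square×unit : ∀ {a} → A a → NonzeroSquare (+ toℕ a) × Unit (+ toℕ a)
  A⇒nonzero-square×unit {a} (a⊥n , jacobi≡1) =
    ((λ q∣a → ℕ.>⇒≢ 1<q (a⊥n (∣⇒∣ᵤ q∣a , ℕ.n∣m*n (p ^ 2)))) ,
     Equivalence.to (isSquareMod⇔square (toℕ a)) (Equivalence.to (jacobi≡1⇔ (toℕ a)) jacobi≡1)) ,
    (λ p∣a → ℕ.>⇒≢ 1<p (a⊥n (∣⇒∣ᵤ p∣a , ℕ.∣-trans (ℕ.m∣m*n (p ℕ.* 1)) (ℕ.m∣m*n q))))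

  nonzero-square×unit⇒A : ∀ {a} → NonzeroSquare (+ toℕ a) → Unit (+ toℕ a) → A a
  nonzero-square×unit⇒A {a} (q∤a , square) p∤a =
    coprime-* (coprime-^2 (prime-∤⇒coprime p-prime (+ toℕ a) p∤a)) (prime-∤⇒coprime q-prime (+ toℕ a) q∤a) ,
    Equivalence.from (jacobi≡1⇔ (toℕ a)) (Equivalence.from (isSquareMod⇔square (toℕ a)) square)

  q∣n : + q ∣ + n
  q∣n = divides (+ p²) (ℤ.pos-* p² q)

  p²∣n : + p² ∣ + n
  p²∣n = divides (+ q) (trans (ℤ.pos-* p² q) (ℤ.*-comm (+ p²) (+ q)))

  combine : ℤ → ℤ → Fin n
  combine α β = reduce (proj₁ (crt p²⊥q α β))

  combine-≡ : ∀ α β → + q ∣ α - + toℕ (combine α β) × + p² ∣ β - + toℕ (combine α β)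
  combine-≡ α β =
    let c , c≡α , c≡β = crt p²⊥q α β
        c′ = + toℕ (reduce c)
    in  ∣-sub-sym c′ α (∣-sub-trans c′ c α (∣-trans q∣n (∣-reduce c)) c≡α) ,
        ∣-sub-sym c′ β (∣-sub-trans c′ c β (∣-trans p²∣n (∣-reduce c)) c≡β)

  -- square weights modulo q and unit weights modulo p² on a common I, glued by the CRT
  upper-bound : AllHaveZeroSum n A 5
  upper-bound x =
    let xs = λ i → + toℕ (x i)
        I , nonempty , none-or-many , contains-zero = zero-sum-pattern (divisibleBy q xs) (valuations p xs)
        reach α α-square Σα≡0 = none-or-many-reaches-0 _ none-or-many (count-reaches I xs)
        reach β β-unit   Σβ≡0 = state-reaches I xs (containsZero-spec _ contains-zero)
        a = λ i → combine (α i) (β i)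
        w = λ i → + toℕ (a i)
        same-terms = λ {m} i (_ : i ∈ I) → ∣-sub-refl {m} (xs i)
        q∣Σ = ∣-weightedSumℤ-cong α w xs xs (∣-sub-0 Σα≡0) (λ i _ → proj₁ (combine-≡ (α i) (β i))) same-terms
        p²∣Σ = ∣-weightedSumℤ-cong β w xs xs (∣-sub-0 Σβ≡0) (λ i _ → proj₂ (combine-≡ (α i) (β i))) same-terms
    in  I , nonempty , a ,
        (λ i i∈I → nonzero-square×unit⇒A (nonzero-square-cong (proj₁ (combine-≡ (α i) (β i))) (α-square i i∈I))
                      (∤-sub-∤ (p²∣⇒p∣ (proj₂ (combine-≡ (α i) (β i)))) (β-unit i i∈I))) ,
        ∣⇒∣ᵤ (subst (+ n ∣_) (sym (weightedSum≡weightedSumℤ 5 I a x)) (coprime-∣⇒*∣ p²⊥q p²∣Σ q∣Σ))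

  r : ℤ
  r = proj₁ nonresidue

  q∤r : ¬ + q ∣ r
  q∤r = proj₁ (proj₂ nonresidue)

  r-nonsquare : ¬ IsSquare r
  r-nonsquare = proj₂ (proj₂ nonresidue)

  free-sequence : Fin 4 → ℤ
  free-sequence Fin.zero                               = + p²
  free-sequence (Fin.suc Fin.zero)                     = - r * + p²
  free-sequence (Fin.suc (Fin.suc Fin.zero))           = + q
  free-sequence (Fin.suc (Fin.suc (Fin.suc Fin.zero))) = + p * + q

  AdmissibleWeights : Subset 4 → (Fin 4 → ℤ) → Set
  AdmissibleWeights I w = ∀ i → i ∈ I → NonzeroSquare (w i) × Unit (w i)

  -- modulo p only the term q survives
  q-term-excluded : ∀ I w → AdmissibleWeights I w → # 2 ∈ I → ¬ + p ∣ weightedSumℤ I w free-sequence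
  q-term-excluded I w w-ok 2∈I p∣Σ = unit-* (proj₂ (w-ok _ 2∈I)) p∤q
    (subst (+ p ∣_) (weightedSumℤ-indicator I w _ (+ q) 2∈I)
      (∣-weightedSumℤ-cong w w free-sequence _ p∣Σ (λ i _ → ∣-sub-refl (w i)) y≡))
    where
      y≡ : ∀ i → i ∈ I → + p ∣ free-sequence i - indicator (# 2) (+ q) i
      y≡ Fin.zero                               _ = ∣⇒∣-sub-0 p∣p²
      y≡ (Fin.suc Fin.zero)                     _ = ∣⇒∣-sub-0 (∣n⇒∣m*n (- r) p∣p²)
      y≡ (Fin.suc (Fin.suc Fin.zero))           _ = ∣-sub-refl (+ q)
      y≡ (Fin.suc (Fin.suc (Fin.suc Fin.zero))) _ = ∣⇒∣-sub-0 (∣m⇒∣m*n (+ q) ∣-refl)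

  -- modulo p² only the term p q survives once q is excluded
  pq-term-excluded : ∀ I w → AdmissibleWeights I w → # 2 ∉ I → # 3 ∈ I →
                     ¬ + p² ∣ weightedSumℤ I w free-sequence
  pq-term-excluded I w w-ok 2∉I 3∈I p²∣Σ = unit-* (proj₂ (w-ok _ 3∈I)) p∤q (p²∣p*⇒p∣
    (subst (+ p² ∣_) (trans (weightedSumℤ-indicator I w _ (+ p * + q) 3∈I) (regroup (w _) (+ p) (+ q)))
      (∣-weightedSumℤ-cong w w free-sequence _ p²∣Σ (λ i _ → ∣-sub-refl (w i)) y≡)))
    where
      regroup : ∀ w p q → w * (p * q) ≡ p * (w * q)
      regroup = solve-∀
      y≡ : ∀ i → i ∈ I → + p² ∣ free-sequence i - indicator (# 3) (+ p * + q) i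
      y≡ Fin.zero                               _   = ∣⇒∣-sub-0 ∣-refl
      y≡ (Fin.suc Fin.zero)                     _   = ∣⇒∣-sub-0 (∣n⇒∣m*n (- r) ∣-refl)
      y≡ (Fin.suc (Fin.suc Fin.zero))           2∈I = ⊥-elim (2∉I 2∈I)
      y≡ (Fin.suc (Fin.suc (Fin.suc Fin.zero))) _   = ∣-sub-refl (+ p * + q)

  -- w₀ ≡ r w₁ with w₀, w₁ squares would make r a square
  p²-terms-excluded : ∀ {w₀ w₁} → NonzeroSquare w₀ → NonzeroSquare w₁ →
                      ¬ + q ∣ w₀ * + p² + (w₁ * (- r * + p²) + 0ℤ)
  p²-terms-excluded {w₀} {w₁} (_ , w₀-square) (q∤w₁ , t , w₁≡t²) q∣Σ =
    [ q∤p² , r-square ]′ (prime-∣-* q-prime (+ p²) (w₀ - r * w₁) (subst (+ q ∣_) (factor w₀ w₁ r (+ p²)) q∣Σ))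
    where
      factor : ∀ w₀ w₁ r P → w₀ * P + (w₁ * (- r * P) + 0ℤ) ≡ P * (w₀ - r * w₁)
      factor = solve-∀
      regroup : ∀ w₀ w₁ r t → w₀ - r * w₁ + r * (w₁ - t * t) ≡ w₀ - r * (t * t)
      regroup = solve-∀
      r-square : ¬ + q ∣ w₀ - r * w₁
      r-square w₀≡rw₁ = r-nonsquare (similar-square (similar-sym (similar t (square-root-∤ t q∤w₁ w₁≡t²)
        (subst (+ q ∣_) (regroup w₀ w₁ r t) (∣m∣n⇒∣m+n w₀≡rw₁ (∣n⇒∣m*n r w₁≡t²))))) w₀-square)

  no-zero-sum : ∀ I w → Nonempty I → AdmissibleWeights I w →
                (∀ {m} → + m ∣ + n → + m ∣ weightedSumℤ I w free-sequence) → ⊥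
  no-zero-sum I@(_ ∷ _ ∷ inside ∷ _ ∷ []) w _ w-ok m∣Σ =
    q-term-excluded I w w-ok (there (there here)) (m∣Σ (∣-trans p∣p² p²∣n))
  no-zero-sum I@(_ ∷ _ ∷ outside ∷ inside ∷ []) w _ w-ok m∣Σ =
    pq-term-excluded I w w-ok (λ { (there (there ())) }) (there (there (there here))) (m∣Σ p²∣n)
  no-zero-sum (inside ∷ outside ∷ outside ∷ outside ∷ []) w _ w-ok m∣Σ =
    ∤-* (proj₁ (proj₁ (w-ok _ here))) q∤p² (∣-sub-0 {a = w Fin.zero * + p²} (m∣Σ q∣n))
  no-zero-sum (outside ∷ inside ∷ outside ∷ outside ∷ []) w _ w-ok m∣Σ =
    ∤-* (proj₁ (proj₁ (w-ok _ (there here)))) (∤-* q∤-r q∤p²)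
        (∣-sub-0 {a = w (# 1) * (- r * + p²)} (m∣Σ q∣n))
    where
      q∤-r : ¬ + q ∣ - r
      q∤-r q∣-r = q∤r (subst (+ q ∣_) (ℤ.neg-involutive r) (∣m⇒∣-m q∣-r))
  no-zero-sum (inside ∷ inside ∷ outside ∷ outside ∷ []) w _ w-ok m∣Σ =
    p²-terms-excluded (proj₁ (w-ok _ here)) (proj₁ (w-ok _ (there here))) (m∣Σ q∣n)
  no-zero-sum (outside ∷ outside ∷ outside ∷ outside ∷ []) w (i , i∈∅) _ _ = ∉⊥ i∈∅

  zero-sum-free : ¬ HasWeightedZeroSum n A 4 (reduce ∘ free-sequence)
  zero-sum-free (I , nonempty , a , a∈A , n∣Σ) =
    no-zero-sum I w nonempty (λ i i∈I → A⇒nonzero-square×unit (a∈A i i∈I)) m∣Σ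
    where
      w : Fin 4 → ℤ
      w i = + toℕ (a i)
      m∣Σ : ∀ {m} → + m ∣ + n → + m ∣ weightedSumℤ I w free-sequence
      m∣Σ m∣n = ∣-weightedSumℤ-cong {I = I} w w (λ i → + toℕ (reduce (free-sequence i))) free-sequence
        (∣-trans m∣n (subst (+ n ∣_) (weightedSum≡weightedSumℤ 4 I a (reduce ∘ free-sequence))
                                     (∣ᵤ⇒∣ {+ n} {+ weightedSum 4 I a (reduce ∘ free-sequence)} n∣Σ)))
        (λ i _ → ∣-sub-refl (w i)) (λ i _ → ∣-trans m∣n (∣-reduce (free-sequence i)))

  lower-bound : ∀ k → k ℕ.< 5 → ¬ AllHaveZeroSum n A k
  lower-bound k k<5 all =
    zero-sum-free (all-have-zero-sum-mono {A = A} (ℕ.≤⇒≤′ (ℕ.s≤s⁻¹ k<5)) all (reduce ∘ free-sequence))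

theorem4p5 : (p′ q : ℕ) → Prime p′ → Prime q → p′ ≢ q → 7 ℕ.≤ p′ → 7 ℕ.≤ q →
    DavenportConst≡ (p′ ^ 2 ℕ.* q) (InS (p′ ^ 2 ℕ.* q) ((p′ , 2) ∷ (q , 1) ∷ [])) 5
theorem4p5 p q p-prime q-prime p≢q 7≤p 7≤q =
  let h , q≡2h+1 = odd-prime q-prime (ℕ.≤-trans (ℕ.m≤m+n 3 4) 7≤q)
      open DavenportConstant p q p-prime q-prime p≢q (ℕ.≤-trans (ℕ.m≤m+n 3 4) 7≤p)
                             h q≡2h+1 (ℕ.≤-trans (ℕ.m≤m+n 6 1) 7≤q)
  in  upper-bound , lower-bound
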